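{- Let $n\ge2$ and let $\mathcal{A}^B_n$ be the set of $B$-arc permutations in $B_n$. Then $$\sum_{\pi\in\mathcal{A}^B_n}t^{\mathrm{fdes}(\pi)}q^{\mathrm{fmaj}(\pi)}=\frac{(1+tq)(1+tq^n)}{1-q}\left((1-tq^n)\prod_{i=1}^{n-2}(1+t^2q^{2i+1})-(1-t)q\prod_{i=1}^{n-2}(1+t^2q^{2i+2})\right),$$ and $$\sum_{\pi\in\mathcal{A}^B_n}t^{\mathrm{fdes}(\pi)}=(1+t)^3 (1+t^2)^{n-3} (1+(n-2)t+t^2).$$
   Context: $B_n$ is the group of bijections $\pi$ of $\{\pm1,\dots,\pm n\}$ with $\pi(-a)=-\pi(a)$, written $\pi=[\pi(1),\dots,\pi(n)]$. Let $\mathcal{O}_n$ be a circle with $2n$ points labeled $-1,\dots,-n,1,\dots,n$ in clockwise order; an interval in $\mathcal{O}_n$ is a set of cyclically consecutive points. $\pi\in B_n$ is a $B$-arc permutation if for every $1\le j\le n$ the set $\{\pi(j),\dots,\pi(n)\}$ is an interval in $\mathcal{O}_n$. Descents are with respect to the order $-1<-2<\cdots<-n<1<\cdots<n$: $\mathrm{Des}(\pi)=\{1\le i\le n-1:\pi(i)>\pi(i+1)\}$, $\mathrm{des}=|\mathrm{Des}|$, $\mathrm{maj}(\pi)=\sum_{i\in\mathrm{Des}(\pi)}i$, $\mathrm{neg}(\pi)=\#\{i:\pi(i)<0\}$, $\mathrm{fmaj}(\pi)=2\,\mathrm{maj}(\pi)+\mathrm{neg}(\pi)$, $\mathrm{fdes}(\pi)=2\,\mathrm{des}(\pi)+\delta(\pi(1)<0)$,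 where $\delta(\pi(1)<0)$ is $1$ if $\pi(1)<0$ and $0$ otherwise. -}

module Defs where

open import Data.Bool using (Bool; true; false; _∧_; _∨_; not; if_then_else_; T?)
open import Data.Nat as ℕ using (ℕ; zero; suc; _∸_; _≡ᵇ_; _<ᵇ_)
open import Data.Nat.DivMod using (_%_)
open import Data.List using (List; []; _∷_; map; concatMap; length; upTo; foldr; filter; _++_; reverse)
open import Data.List.Relation.Unary.Any using (any?)
open import Data.Integer as ℤ using (ℤ; +_; -[1+_])
open import Relation.Nullary.Decidable using (Dec; yes; no)
open import Relation.Binary.PropositionalEquality using (_≡_; refl)

-- Signed permutations are represented by their window [π(1),…,π(n)],
-- a list of nonzero integers.

signedVals : ℕ → List ℤ
signedVals n = map (λ i → + suc i) (upTo n) ++ map (λ i → -[1+ i ]) (upTo n)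

words : List ℤ → ℕ → List (List ℤ)
words vs zero = [] ∷ []
words vs (suc k) = concatMap (λ v → map (v ∷_) (words vs k)) vs

elemᵇ : ℕ → List ℕ → Bool
elemᵇ x [] = false
elemᵇ x (y ∷ ys) = (x ≡ᵇ y) ∨ elemᵇ x ys

distinctᵇ : List ℕ → Bool
distinctᵇ [] = true
distinctᵇ (x ∷ xs) = not (elemᵇ x xs) ∧ distinctᵇ xs

isSignedPerm : List ℤ → Bool
isSignedPerm w = distinctᵇ (map ℤ.∣_∣ w)

Bn : ℕ → List (List ℤ)
Bn n = filter (λ w → T? (isSignedPerm w)) (words (signedVals n) n)

-- position on the circle O_n: -1,…,-n,1,…,n clockwise get positions 0,…,2n-1.
-- This is also the total order -1 < -2 < … < -n < 1 < … < n used for descents.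
pos : ℕ → ℤ → ℕ
pos n (+ a) = n ℕ.+ (a ∸ 1)
pos n -[1+ a ] = a

allᵇ : {A : Set} → (A → Bool) → List A → Bool
allᵇ p [] = true
allᵇ p (x ∷ xs) = p x ∧ allᵇ p xs

anyᵇ : {A : Set} → (A → Bool) → List A → Bool
anyᵇ p [] = false
anyᵇ p (x ∷ xs) = p x ∨ anyᵇ p xs

window : ℕ → ℕ → ℕ → List ℕ
window n s L = map (λ k → (s ℕ.+ k) % suc ((n ℕ.+ n) ∸ 1)) (upTo L)
-- note: suc ((n + n) ∸ 1) = 2n for n ≥ 1 (used only for n ≥ 2)

isWindowAt : ℕ → List ℕ → ℕ → ℕ → Bool
isWindowAt n P L s = allᵇ (λ p → elemᵇ p W) P ∧ allᵇ (λ p → elemᵇ p P) W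
  where W = window n s L

isInterval : ℕ → List ℤ → Bool
isInterval n S = anyᵇ (isWindowAt n (map (pos n) S) (length S)) (upTo (n ℕ.+ n))

suffixes : List ℤ → List (List ℤ)
suffixes [] = []
suffixes (x ∷ xs) = (x ∷ xs) ∷ suffixes xs

isBArc : ℕ → List ℤ → Bool
isBArc n w = allᵇ (isInterval n) (suffixes w)

ABn : ℕ → List (List ℤ)
ABn n = filter (λ w → T? (isBArc n w)) (Bn n)

descentPositions : ℕ → ℕ → List ℤ → List ℕ
descentPositions n i [] = []
descentPositions n i (x ∷ []) = []
descentPositions n i (x ∷ y ∷ ys) =
  (if pos n y <ᵇ pos n x then i ∷ [] else []) ++ descentPositions n (suc i) (y ∷ ys)

Des : ℕ → List ℤ → List ℕ
Des n w = descentPositions n 1 w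

des : ℕ → List ℤ → ℕ
des n w = length (Des n w)

maj : ℕ → List ℤ → ℕ
maj n w = foldr ℕ._+_ 0 (Des n w)

isNeg : ℤ → Bool
isNeg (+ _) = false
isNeg -[1+ _ ] = true

neg : List ℤ → ℕ
neg w = length (filter (λ x → T? (isNeg x)) w)

fmaj : ℕ → List ℤ → ℕ
fmaj n w = 2 ℕ.* maj n w ℕ.+ neg w

firstNeg : List ℤ → ℕ
firstNeg [] = 0
firstNeg (x ∷ _) = if isNeg x then 1 else 0

fdes : ℕ → List ℤ → ℕ
fdes n w = 2 ℕ.* des n w ℕ.+ firstNeg w

sumℤ : List ℤ → ℤ
sumℤ = foldr ℤ._+_ (+ 0)

prodFrom1 : ℕ → (ℕ → ℤ) → ℤ
prodFrom1 zero f = + 1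
prodFrom1 (suc m) f = prodFrom1 m f ℤ.* f (suc m)

genFun : ℕ → ℤ → ℤ → ℤ
genFun n t q = sumℤ (map (λ w → (t ℤ.^ fdes n w) ℤ.* (q ℤ.^ fmaj n w)) (ABn n))

fdesGen : ℕ → ℤ → ℤ
fdesGen n t = sumℤ (map (λ w → t ℤ.^ fdes n w) (ABn n))

module Submission where

-- A B-arc permutation is built from its
-- last letter backwards: every suffix π(j),…,π(n) occupies a cyclic window,
-- and π(j-1) must be one of the two circle points adjacent to that window.
-- Hence a B-arc permutation is encoded by the start s of the window of its
-- last letter and a list of n-1 left/right choices (Encoding), and summing
-- over B-arc permutations becomes Σ_s Σ_choices (Enumeration).  Prepending a
-- letter changes des, maj and neg in a controlled way (Statistics), so for a
-- fixed start s the sum over the choices satisfies a two-term recursion: it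
-- is a product for windows that do not wrap around the circle and a
-- two-parameter family for wrapping ones (Windows).  Summing over s and
-- solving the resulting recursions in closed form, with the integer ring
-- solver for the algebra, gives the (t, q)-identity (Expansion); the
-- t-identity is the specialisation q = 1 of the same expansion (AtQ1).

open import Data.Nat using (ℕ)
open import Data.Integer using (ℤ)

module Sums where

  open import Defs using (sumℤ)
  open import Data.Nat as ℕ using (ℕ; _<_; zero; suc; s≤s; z≤n)
  open import Data.Integer using (ℤ; +_; _+_; _*_)
  open import Data.Bool using (Bool; true; false; _∧_; _∨_; if_then_else_)
  open import Data.List using (List; []; _∷_; map; concatMap; applyUpTo; filter; _++_; length)
  open import Data.Empty using (⊥; ⊥-elim)
  open import Relation.Nullary.Decidable using (T?)
  open import Relation.Binary.PropositionalEquality using (_≡_; refl; sym; trans; cong; cong₂; module ≡-Reasoning)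
  import Data.Integer.Properties as ZP
  open import Algebra.Properties.CommutativeSemigroup ZP.+-commutativeSemigroup using (interchange)

  sumOver : {A : Set} → List A → (A → ℤ) → ℤ
  sumOver xs f = sumℤ (map f xs)

  module _ {A : Set} where
    sumOver-++ : (xs ys : List A) (f : A → ℤ) → sumOver (xs ++ ys) f ≡ sumOver xs f + sumOver ys f
    sumOver-++ [] ys f = sym (ZP.+-identityˡ _)
    sumOver-++ (x ∷ xs) ys f = trans (cong (_+_ (f x)) (sumOver-++ xs ys f)) (sym (ZP.+-assoc (f x) _ _))

    sumOver-cong : (xs : List A) {f g : A → ℤ} → (∀ x → f x ≡ g x) → sumOver xs f ≡ sumOver xs g
    sumOver-cong [] e = refl
    sumOver-cong (x ∷ xs) e = cong₂ _+_ (e x) (sumOver-cong xs e)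

    sumOver-+ : (xs : List A) (f g : A → ℤ) → sumOver xs (λ x → f x + g x) ≡ sumOver xs f + sumOver xs g
    sumOver-+ [] f g = refl
    sumOver-+ (x ∷ xs) f g =
      trans (cong (_+_ (f x + g x)) (sumOver-+ xs f g)) (interchange (f x) (g x) (sumOver xs f) (sumOver xs g))

    sumOver-0 : (xs : List A) → sumOver xs (λ _ → + 0) ≡ + 0
    sumOver-0 [] = refl
    sumOver-0 (x ∷ xs) = cong (_+_ (+ 0)) (sumOver-0 xs)

    sumOver-*ˡ : (c : ℤ) (xs : List A) (f : A → ℤ) → c * sumOver xs f ≡ sumOver xs (λ x → c * f x)
    sumOver-*ˡ c [] f = ZP.*-zeroʳ c
    sumOver-*ˡ c (x ∷ xs) f = trans (ZP.*-distribˡ-+ c (f x) _) (cong (_+_ (c * f x)) (sumOver-*ˡ c xs f))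

  module _ {A B : Set} where
    sumOver-map : (g : A → B) (xs : List A) (f : B → ℤ) → sumOver (map g xs) f ≡ sumOver xs (λ x → f (g x))
    sumOver-map g [] f = refl
    sumOver-map g (x ∷ xs) f = cong (_+_ (f (g x))) (sumOver-map g xs f)

    sumOver-concatMap : (h : A → List B) (xs : List A) (f : B → ℤ) →
      sumOver (concatMap h xs) f ≡ sumOver xs (λ x → sumOver (h x) f)
    sumOver-concatMap h [] f = refl
    sumOver-concatMap h (x ∷ xs) f =
      trans (sumOver-++ (h x) (concatMap h xs) f) (cong (_+_ (sumOver (h x) f)) (sumOver-concatMap h xs f))

    sumOver-swap : (xs : List A) (ys : List B) (g : A → B → ℤ) →
      sumOver xs (λ x → sumOver ys (g x)) ≡ sumOver ys (λ y → sumOver xs (λ x → g x y))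
    sumOver-swap [] ys g = sym (sumOver-0 ys)
    sumOver-swap (x ∷ xs) ys g = trans (cong (_+_ (sumOver ys (g x))) (sumOver-swap xs ys g))
      (sym (sumOver-+ ys (g x) (λ y → sumOver xs (λ x′ → g x′ y))))

  when : Bool → ℤ → ℤ
  when b z = if b then z else + 0

  when-∧ : ∀ a b z → when (a ∧ b) z ≡ when a (when b z)
  when-∧ false b z = refl
  when-∧ true b z = refl

  when-∨ : ∀ a b z → (a ≡ true → b ≡ true → ⊥) → when (a ∨ b) z ≡ when a z + when b z
  when-∨ true true z disjoint = ⊥-elim (disjoint refl refl)
  when-∨ true false z _ = sym (ZP.+-identityʳ z)
  when-∨ false true z _ = sym (ZP.+-identityˡ z)
  when-∨ false false z _ = refl

  when-sumOver : {A : Set} (b : Bool) (xs : List A) (f : A → ℤ) →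
    when b (sumOver xs f) ≡ sumOver xs (λ x → when b (f x))
  when-sumOver false xs f = sym (sumOver-0 xs)
  when-sumOver true xs f = refl

  sumOver-filter : {A : Set} (p : A → Bool) (xs : List A) (f : A → ℤ) →
    sumOver (filter (λ x → T? (p x)) xs) f ≡ sumOver xs (λ x → when (p x) (f x))
  sumOver-filter p [] f = refl
  sumOver-filter p (x ∷ xs) f with p x
  ... | true = cong (_+_ (f x)) (sumOver-filter p xs f)
  ... | false = trans (sumOver-filter p xs f) (sym (ZP.+-identityˡ _))

  sumBelow : ℕ → (ℕ → ℤ) → ℤ
  sumBelow zero f = + 0
  sumBelow (suc n) f = f 0 + sumBelow n (λ i → f (suc i))

  sumOver-applyUpTo : (g : ℕ → ℕ) (n : ℕ) (f : ℕ → ℤ) → sumOver (applyUpTo g n) f ≡ sumBelow n (λ i → f (g i))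
  sumOver-applyUpTo g zero f = refl
  sumOver-applyUpTo g (suc n) f = cong (_+_ (f (g 0))) (sumOver-applyUpTo (λ i → g (suc i)) n f)

  sumBelow-cong : (n : ℕ) {f g : ℕ → ℤ} → (∀ i → i < n → f i ≡ g i) → sumBelow n f ≡ sumBelow n g
  sumBelow-cong zero e = refl
  sumBelow-cong (suc n) e = cong₂ _+_ (e 0 (s≤s z≤n)) (sumBelow-cong n (λ i i<n → e (suc i) (s≤s i<n)))

  sumBelow-+ : (n : ℕ) (f g : ℕ → ℤ) → sumBelow n (λ i → f i + g i) ≡ sumBelow n f + sumBelow n g
  sumBelow-+ zero f g = refl
  sumBelow-+ (suc n) f g =
    trans (cong (_+_ (f 0 + g 0)) (sumBelow-+ n (λ i → f (suc i)) (λ i → g (suc i))))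
          (interchange (f 0) (g 0) _ _)

  sumBelow-*ˡ : (c : ℤ) (n : ℕ) (f : ℕ → ℤ) → c * sumBelow n f ≡ sumBelow n (λ i → c * f i)
  sumBelow-*ˡ c zero f = ZP.*-zeroʳ c
  sumBelow-*ˡ c (suc n) f = trans (ZP.*-distribˡ-+ c (f 0) _) (cong (_+_ (c * f 0)) (sumBelow-*ˡ c n (λ i → f (suc i))))

  sumBelow-snoc : (n : ℕ) (f : ℕ → ℤ) → sumBelow (suc n) f ≡ sumBelow n f + f n
  sumBelow-snoc zero f = ZP.+-comm (f 0) (+ 0)
  sumBelow-snoc (suc n) f = trans (cong (_+_ (f 0)) (sumBelow-snoc n (λ i → f (suc i)))) (sym (ZP.+-assoc (f 0) _ _))

  sumBelow-split : (a b : ℕ) (f : ℕ → ℤ) → sumBelow (a ℕ.+ b) f ≡ sumBelow a f + sumBelow b (λ i → f (a ℕ.+ i))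
  sumBelow-split zero b f = sym (ZP.+-identityˡ _)
  sumBelow-split (suc a) b f =
    trans (cong (_+_ (f 0)) (sumBelow-split a b (λ i → f (suc i)))) (sym (ZP.+-assoc (f 0) _ _))

  sumBelow-const : (n : ℕ) (c : ℤ) → sumBelow n (λ _ → c) ≡ + n * c
  sumBelow-const zero c = sym (ZP.*-zeroˡ c)
  sumBelow-const (suc n) c = trans (cong (_+_ c) (sumBelow-const n c)) (sym (ZP.suc-* (+ n) c))

  sumBelow-pick : ∀ m a (h : ℕ → ℤ) → a < m → sumBelow m (λ p → when (p ℕ.≡ᵇ a) (h p)) ≡ h a
  sumBelow-pick (suc m) zero h _ =
    trans (cong (_+_ (h 0)) (trans (sumBelow-const m (+ 0)) (ZP.*-zeroʳ (+ m)))) (ZP.+-identityʳ (h 0))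
  sumBelow-pick (suc m) (suc a) h (s≤s a<m) = trans (ZP.+-identityˡ _) (sumBelow-pick m a (λ p → h (suc p)) a<m)

  choices : ℕ → List (List Bool)
  choices zero = [] ∷ []
  choices (suc k) = map (false ∷_) (choices k) ++ map (true ∷_) (choices k)

  sumOver-choices : ∀ k (h : List Bool → ℤ) →
    sumOver (choices (suc k)) h ≡ sumOver (choices k) (λ ch → h (false ∷ ch)) + sumOver (choices k) (λ ch → h (true ∷ ch))
  sumOver-choices k h =
    trans (sumOver-++ (map (false ∷_) (choices k)) _ h) (cong₂ _+_ (sumOver-map (false ∷_) (choices k) h) (sumOver-map (true ∷_) (choices k) h))

  sumOver-choices-cong : ∀ k {f g : List Bool → ℤ} → (∀ ch → length ch ≡ k → f ch ≡ g ch) →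
    sumOver (choices k) f ≡ sumOver (choices k) g
  sumOver-choices-cong zero e = cong (_+ + 0) (e [] refl)
  sumOver-choices-cong (suc k) {f} {g} e = begin
      sumOver (choices (suc k)) f
    ≡⟨ sumOver-choices k f ⟩
      sumOver (choices k) (λ ch → f (false ∷ ch)) + sumOver (choices k) (λ ch → f (true ∷ ch))
    ≡⟨ cong₂ _+_ (sumOver-choices-cong k (λ ch l → e (false ∷ ch) (cong suc l)))
                 (sumOver-choices-cong k (λ ch l → e (true ∷ ch) (cong suc l))) ⟩
      sumOver (choices k) (λ ch → g (false ∷ ch)) + sumOver (choices k) (λ ch → g (true ∷ ch))
    ≡⟨ sym (sumOver-choices k g) ⟩
      sumOver (choices (suc k)) g ∎
    where open ≡-Reasoning

module CyclicArithmetic where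

  open import Data.Nat using (ℕ; _≤_; _<_; zero; suc; _+_; _∸_; s≤s; _%_; _<?_)
  open import Data.Nat.DivMod using (m<n⇒m%n≡m; %-distribˡ-+; m%n%n≡m%n; [m+n]%n≡m%n; m%n<n)
  open import Data.Product using (_×_; _,_; Σ)
  open import Data.Sum using (_⊎_; inj₁; inj₂)
  open import Data.Empty using (⊥-elim)
  open import Relation.Nullary using (yes; no)
  open import Relation.Binary.PropositionalEquality using (_≡_; refl; sym; trans; cong; cong₂; subst; module ≡-Reasoning)
  open import Data.Nat.Properties
  import Data.Nat.Tactic.RingSolver as NS

  ≤-by : ∀ {a b} c → a + c ≡ b → a ≤ b
  ≤-by {a} c eq = subst (a ≤_) eq (m≤m+n a c)

  module Cyclic (M' : ℕ) where
    M : ℕ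
    M = suc M'

    add : ℕ → ℕ → ℕ
    add s j = (s + j) % M

    add-lt : ∀ s j → add s j < M
    add-lt s j = m%n<n (s + j) M

    %-small : ∀ {a} → a < M → a % M ≡ a
    %-small = m<n⇒m%n≡m

    %-wrap : ∀ c → c < M → (M + c) % M ≡ c
    %-wrap c c<M = trans (cong (_% M) (+-comm M c)) (trans ([m+n]%n≡m%n c M) (%-small c<M))

    mod-cases : ∀ x → x < M + M → (x < M × x % M ≡ x) ⊎ (Σ ℕ λ c → x ≡ M + c × c < M × x % M ≡ c)
    mod-cases x lt with x <? M
    ... | yes x<M = inj₁ (x<M , %-small x<M)
    ... | no x≮M with c , refl ← m≤n⇒∃[o]m+o≡n (≮⇒≥ x≮M) =
      inj₂ (c , refl , +-cancelˡ-< M c M lt , %-wrap c (+-cancelˡ-< M c M lt))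

    add-modr : ∀ s a → add s (a % M) ≡ add s a
    add-modr s a = begin
        (s + a % M) % M             ≡⟨ %-distribˡ-+ s (a % M) M ⟩
        (s % M + a % M % M) % M     ≡⟨ cong (λ z → (s % M + z) % M) (m%n%n≡m%n a M) ⟩
        (s % M + a % M) % M         ≡⟨ sym (%-distribˡ-+ s a M) ⟩
        (s + a) % M                 ∎
      where open ≡-Reasoning

    add-add : ∀ s a b → add (add s a) b ≡ add s (a + b)
    add-add s a b = begin
        ((s + a) % M + b) % M             ≡⟨ %-distribˡ-+ ((s + a) % M) b M ⟩
        ((s + a) % M % M + b % M) % M     ≡⟨ cong (λ z → (z + b % M) % M) (m%n%n≡m%n (s + a) M) ⟩
        ((s + a) % M + b % M) % M         ≡⟨ sym (%-distribˡ-+ (s + a) b M) ⟩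
        (s + a + b) % M                   ≡⟨ cong (_% M) (+-assoc s a b) ⟩
        (s + (a + b)) % M                 ∎
      where open ≡-Reasoning

    add-0 : ∀ {s} → s < M → add s 0 ≡ s
    add-0 {s} lt = trans (cong (_% M) (+-identityʳ s)) (%-small lt)

    add-small : ∀ {s j} → s + j < M → add s j ≡ s + j
    add-small lt = %-small lt

    add-M : ∀ {s} → s < M → add s M ≡ s
    add-M {s} lt = trans ([m+n]%n≡m%n s M) (%-small lt)

    add-M+ : ∀ s j → add s (M + j) ≡ add s j
    add-M+ s j = trans (cong (_% M) (eq s j M)) ([m+n]%n≡m%n (s + j) M)
      where eq : ∀ s j m → s + (m + j) ≡ s + j + m
            eq = NS.solve-∀

    add-pred-suc : ∀ s j → add (add s M') (suc j) ≡ add s j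
    add-pred-suc s j = trans (add-add s M' (suc j)) (trans (cong (add s) (+-suc M' j)) (add-M+ s j))

    add-M'-suc : ∀ {j} → j < M → add M' (suc j) ≡ j
    add-M'-suc {j} j<M = trans (cong (_% M) (+-suc M' j)) (%-wrap j j<M)

    around : ∀ {s} a → s ≤ M → s + (a + (M ∸ s)) ≡ a + M
    around {s} a s≤M = trans (sym (+-assoc s a (M ∸ s))) (trans (cong (_+ (M ∸ s)) (+-comm s a))
      (trans (+-assoc a s (M ∸ s)) (cong (a +_) (m+[n∸m]≡n s≤M))))

    add-back : ∀ {s a} → s ≤ M → a < M → add (add s a) (M ∸ s) ≡ a
    add-back {s} {a} s≤M a<M = begin
        add (add s a) (M ∸ s)   ≡⟨ add-add s a (M ∸ s) ⟩
        (s + (a + (M ∸ s))) % M ≡⟨ cong (_% M) (around a s≤M) ⟩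
        (a + M) % M             ≡⟨ [m+n]%n≡m%n a M ⟩
        a % M                   ≡⟨ %-small a<M ⟩
        a                       ∎
      where open ≡-Reasoning

    add-inj : ∀ {s a b} → s ≤ M → a < M → b < M → add s a ≡ add s b → a ≡ b
    add-inj {s} {a} {b} s≤M a<M b<M eq =
      trans (sym (add-back s≤M a<M)) (trans (cong (λ z → add z (M ∸ s)) eq) (add-back s≤M b<M))

    add-section : ∀ {s p} → s ≤ M → p < M → add s (add p (M ∸ s)) ≡ p
    add-section {s} {p} s≤M p<M = begin
        add s ((p + (M ∸ s)) % M) ≡⟨ add-modr s (p + (M ∸ s)) ⟩
        (s + (p + (M ∸ s))) % M   ≡⟨ cong (_% M) (around p s≤M) ⟩
        (p + M) % M               ≡⟨ [m+n]%n≡m%n p M ⟩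
        p % M                     ≡⟨ %-small p<M ⟩
        p                         ∎
      where open ≡-Reasoning

    module TwoPointWindow (k : ℕ) (hM : k + k + 4 ≤ M) where
      i<M : ∀ {i} → i ≤ suc k → i < M
      i<M le = ≤-<-trans le (≤-trans (≤-by (k + 2) (lem k)) hM)
        where lem : ∀ k → suc (suc k) + (k + 2) ≡ k + k + 4
              lem = NS.solve-∀

      e+i<2M : ∀ {e i} → e < M → i ≤ suc k → e + i < M + M
      e+i<2M e<M le = +-mono-< e<M (i<M le)

      start-before-0 : ∀ e i₁ i₂ → e < M → i₁ ≤ suc k → i₂ ≤ suc k →
        e + i₁ ≡ M → k ≡ add e i₂ → e ≡ M'
      start-before-0 e i₁ i₂ e<M h1 h2 eM E2 with mod-cases (e + i₂) (e+i<2M e<M h2)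
      ... | inj₁ (_ , r2) = ⊥-elim (<⇒≱ (≤-by 2 (lem k)) tooLong)
        where
          -- k = e + i₂ ≥ e ≥ M - (k+1), contradicting M ≥ 2k+4
          tooLong : k + k + 4 ≤ k + suc k
          tooLong = ≤-trans hM (≤-trans (≤-reflexive (sym eM)) (≤-trans (+-monoʳ-≤ e h1)
            (≤-trans (+-monoˡ-≤ (suc k) (m≤m+n e i₂)) (≤-reflexive (cong (_+ suc k) (sym (trans E2 r2)))))))
          lem : ∀ k → suc (k + suc k) + 2 ≡ k + k + 4
          lem = NS.solve-∀
      ... | inj₂ (c2 , eq2 , _ , r2) = from-i₁ i₁ eM i₂≡i₁+k
        where
          -- e + i₂ = M + k = e + i₁ + k
          i₂≡i₁+k : i₂ ≡ i₁ + k
          i₂≡i₁+k = +-cancelˡ-≡ e i₂ (i₁ + k)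
            (trans eq2 (trans (cong₂ _+_ (sym eM) (sym (trans E2 r2))) (+-assoc e i₁ k)))
          from-i₁ : ∀ j → e + j ≡ M → i₂ ≡ j + k → e ≡ M'
          from-i₁ zero eM0 _ = ⊥-elim (<-irrefl (trans (sym (+-identityʳ e)) eM0) e<M)
          from-i₁ (suc zero) eM1 _ = suc-injective (trans (+-comm 1 e) eM1)
          from-i₁ (suc (suc j)) _ i₂≡ = ⊥-elim (<⇒≱ (≤-by j (lem j k)) (subst (_≤ suc k) i₂≡ h2))
            where lem : ∀ j k → suc (suc k) + j ≡ suc (suc j) + k
                  lem = NS.solve-∀

      window-start : ∀ e i₁ i₂ → e < M → i₁ ≤ suc k → i₂ ≤ suc k →
        0 ≡ add e i₁ → k ≡ add e i₂ → (e ≡ 0) ⊎ (e ≡ M')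
      window-start zero _ _ _ _ _ _ _ = inj₁ refl
      window-start (suc e') i₁ i₂ e<M h1 h2 E1 E2 with mod-cases (suc e' + i₁) (e+i<2M e<M h1)
      ... | inj₁ (_ , r1) with () ← trans E1 r1
      ... | inj₂ (c1 , eq1 , _ , r1) =
        inj₂ (start-before-0 (suc e') i₁ i₂ e<M h1 h2 (trans eq1 (trans (cong (M +_) (sym (trans E1 r1))) (+-identityʳ M))) E2)

      window-through-0-and-k : ∀ e d i₀ i₁ i₂ → e < M → k < d →
        i₀ ≤ suc k → i₁ ≤ suc k → i₂ ≤ suc k →
        d ≡ add e i₀ → 0 ≡ add e i₁ → k ≡ add e i₂ → (d ≡ suc k) ⊎ (d ≡ M')
      window-through-0-and-k e d i₀ i₁ i₂ e<M k<d h0 h1 h2 E0 E1 E2 with window-start e i₁ i₂ e<M h1 h2 E1 E2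
      ... | inj₁ refl = inj₁ (≤-antisym (subst (_≤ suc k) (sym (trans E0 (%-small (i<M h0)))) h0) k<d)
      ... | inj₂ refl = after-M' i₀ h0 E0
        where
          after-M' : ∀ i → i ≤ suc k → d ≡ add M' i → (d ≡ suc k) ⊎ (d ≡ M')
          after-M' zero _ E = inj₂ (trans E (trans (cong (_% M) (+-identityʳ M')) (%-small ≤-refl)))
          after-M' (suc j) (s≤s j≤k) E =
            ⊥-elim (<⇒≱ k<d (subst (_≤ k) (sym (trans E (add-M'-suc (i<M (m≤n⇒m≤1+n j≤k))))) j≤k))

module Reflection where

  open import Defs using (elemᵇ; allᵇ; anyᵇ)
  open import Data.Nat as ℕ using (ℕ; _≤_; _<_; _<ᵇ_; _≡ᵇ_)
  open import Data.Product using (_×_; _,_; proj₁; proj₂; Σ)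
  open import Data.Sum using (_⊎_; inj₁; inj₂)
  open import Data.Empty using (⊥; ⊥-elim)
  open import Data.Unit using (tt)
  open import Data.Bool using (Bool; true; false; _∧_; _∨_; not; T)
  open import Data.Bool.Properties using (∨-zeroʳ)
  open import Data.List using (List; _∷_; [])
  open import Data.List.Membership.Propositional using (_∈_)
  open import Data.List.Relation.Unary.Any using (here; there)
  open import Relation.Nullary using (yes; no)
  open import Relation.Binary.PropositionalEquality using (_≡_; refl; sym; subst)
  open import Data.Nat.Properties using (≡⇒≡ᵇ; ≡ᵇ⇒≡; <⇒<ᵇ; <ᵇ⇒<; <⇒≱; ≮⇒≥)

  T⇒≡ : ∀ {b} → T b → b ≡ true
  T⇒≡ {true} _ = refl

  ≡⇒T : ∀ {b} → b ≡ true → T b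
  ≡⇒T refl = tt

  ∧-true : ∀ {a b} → (a ∧ b) ≡ true → a ≡ true × b ≡ true
  ∧-true {true} {true} _ = refl , refl

  true-∧ : ∀ {a b} → a ≡ true → b ≡ true → (a ∧ b) ≡ true
  true-∧ refl refl = refl

  ∨-true : ∀ {a b} → (a ∨ b) ≡ true → (a ≡ true) ⊎ (b ≡ true)
  ∨-true {true} _ = inj₁ refl
  ∨-true {false} e = inj₂ e

  bool-ext : ∀ {a b} → (a ≡ true → b ≡ true) → (b ≡ true → a ≡ true) → a ≡ b
  bool-ext {false} {false} f g = refl
  bool-ext {false} {true} f g = g refl
  bool-ext {true} {false} f g = sym (f refl)
  bool-ext {true} {true} f g = refl

  not-true : ∀ {b} → (b ≡ true → ⊥) → not b ≡ true
  not-true {false} _ = refl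
  not-true {true} f = ⊥-elim (f refl)

  not-elim : ∀ {b} → not b ≡ true → b ≡ true → ⊥
  not-elim {true} () _


  ≡ᵇ-true : ∀ {a b} → a ≡ b → (a ≡ᵇ b) ≡ true
  ≡ᵇ-true {a} {b} e = T⇒≡ (≡⇒≡ᵇ a b e)

  ≡ᵇ-≡ : ∀ {a b} → (a ≡ᵇ b) ≡ true → a ≡ b
  ≡ᵇ-≡ {a} {b} e = ≡ᵇ⇒≡ a b (≡⇒T e)

  <ᵇ-true : ∀ {a b} → a < b → (a <ᵇ b) ≡ true
  <ᵇ-true lt = T⇒≡ (<⇒<ᵇ lt)

  <ᵇ-false : ∀ {a b} → b ≤ a → (a <ᵇ b) ≡ false
  <ᵇ-false {a} {b} le with a <ᵇ b in eq
  ... | false = refl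
  ... | true = ⊥-elim (<⇒≱ (<ᵇ⇒< a b (≡⇒T eq)) le)

  <ᵇ-t⇒ : ∀ {a b} → (a <ᵇ b) ≡ true → a < b
  <ᵇ-t⇒ {a} {b} e = <ᵇ⇒< a b (≡⇒T e)

  <ᵇ-f⇒ : ∀ {a b} → (a <ᵇ b) ≡ false → b ≤ a
  <ᵇ-f⇒ {a} {b} e with a ℕ.<? b
  ... | yes lt = ⊥-elim (subst T e (<⇒<ᵇ lt))
  ... | no nlt = ≮⇒≥ nlt

  elem⇒ : ∀ {x} ys → elemᵇ x ys ≡ true → x ∈ ys
  elem⇒ {x} (y ∷ ys) e with ∨-true {x ≡ᵇ y} e
  ... | inj₁ h = here (≡ᵇ-≡ h)
  ... | inj₂ h = there (elem⇒ ys h)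

  elem⇐ : ∀ {x ys} → x ∈ ys → elemᵇ x ys ≡ true
  elem⇐ {x} {y ∷ ys} (here refl) rewrite ≡ᵇ-true {x} {x} refl = refl
  elem⇐ {x} {y ∷ ys} (there m) rewrite elem⇐ m = ∨-zeroʳ (x ≡ᵇ y)

  allᵇ⇒ : ∀ {A : Set} {p : A → Bool} xs → allᵇ p xs ≡ true → ∀ {x} → x ∈ xs → p x ≡ true
  allᵇ⇒ (y ∷ ys) e (here refl) = proj₁ (∧-true e)
  allᵇ⇒ (y ∷ ys) e (there m) = allᵇ⇒ ys (proj₂ (∧-true e)) m

  allᵇ⇐ : ∀ {A : Set} {p : A → Bool} xs → (∀ {x} → x ∈ xs → p x ≡ true) → allᵇ p xs ≡ true
  allᵇ⇐ [] f = refl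
  allᵇ⇐ (y ∷ ys) f = true-∧ (f (here refl)) (allᵇ⇐ ys (λ m → f (there m)))

  anyᵇ⇒ : ∀ {A : Set} {p : A → Bool} xs → anyᵇ p xs ≡ true → Σ A λ x → x ∈ xs × p x ≡ true
  anyᵇ⇒ {p = p} (y ∷ ys) e with ∨-true {p y} e
  ... | inj₁ h = y , here refl , h
  ... | inj₂ h with anyᵇ⇒ ys h
  ... | x , m , px = x , there m , px

  anyᵇ⇐ : ∀ {A : Set} {p : A → Bool} {x} xs → x ∈ xs → p x ≡ true → anyᵇ p xs ≡ true
  anyᵇ⇐ {p = p} (y ∷ ys) (here refl) px rewrite px = refl
  anyᵇ⇐ {p = p} (y ∷ ys) (there m) px rewrite anyᵇ⇐ {p = p} ys m px = ∨-zeroʳ (p y)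

module Encoding where

  open import Defs
  open CyclicArithmetic
  open import Data.Nat using (ℕ; _≤_; _<_; zero; suc; _+_; _∸_; z≤n; s≤s; _%_; _<ᵇ_; _≡ᵇ_)
  open import Data.Integer as ℤ using (ℤ; +_; -[1+_])
  open import Data.Product using (_×_; _,_; proj₁; proj₂; Σ)
  open import Data.Sum using (_⊎_; inj₁; inj₂)
  open import Data.Empty using (⊥)
  open import Data.Bool using (Bool; true; false; _∧_; _∨_; not; if_then_else_)
  open import Data.List using (List; []; _∷_; map; length; upTo)
  open import Data.List.Membership.Propositional using (_∈_)
  open import Data.List.Membership.Propositional.Properties using (∈-map⁺; ∈-map⁻; ∈-upTo⁺; ∈-upTo⁻)
  open import Data.List.Relation.Unary.Any using (here; there)
  open import Relation.Binary.PropositionalEquality using (_≡_; refl; sym; trans; cong; cong₂; subst)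
  open import Data.Nat.Properties
  import Data.Nat.Tactic.RingSolver as NS
  import Data.List.Properties as LP
  open Reflection

  module Circle (n' : ℕ) where
    n : ℕ
    n = suc n'

    M' : ℕ
    M' = n' + suc n'

    open Cyclic M' public

    valAt : ℕ → ℤ
    valAt p = if p <ᵇ n then -[1+ p ] else + suc (p ∸ n)

    pos-valAt : ∀ p → pos n (valAt p) ≡ p
    pos-valAt p with p <ᵇ n in e
    ... | true = refl
    ... | false = m+[n∸m]≡n (<ᵇ-f⇒ {p} {n} e)

    isNeg-valAt : ∀ p → isNeg (valAt p) ≡ (p <ᵇ n)
    isNeg-valAt p with p <ᵇ n
    ... | true = refl
    ... | false = refl

    abs-valAt : ∀ {a b} → a < M → b < M → ℤ.∣ valAt a ∣ ≡ ℤ.∣ valAt b ∣ → (b ≡ a) ⊎ (b ≡ add a n)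
    abs-valAt {a} {b} a<M b<M e with a <ᵇ n in ea | b <ᵇ n in eb
    ... | true | true = inj₁ (sym (suc-injective e))
    ... | true | false = inj₂ (trans b≡ (sym (add-small {a} {n} a+n<M)))
      where
        a≡ : a ≡ b ∸ n
        a≡ = suc-injective e
        b≡ : b ≡ a + n
        b≡ = trans (sym (m∸n+n≡m {b} {n} (<ᵇ-f⇒ {b} {n} eb))) (cong (_+ n) (sym a≡))
        a+n<M : a + n < M
        a+n<M = +-monoˡ-< n (<ᵇ-t⇒ {a} {n} ea)
    ... | false | true = inj₂ (trans b≡ (sym wrap))
      where
        b≡ : b ≡ a ∸ n
        b≡ = sym (suc-injective e)
        wrap : add a n ≡ a ∸ n
        wrap = trans (cong (_% M) eq) (%-wrap (a ∸ n) (≤-<-trans (m∸n≤m a n) a<M))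
          where eq : a + n ≡ M + (a ∸ n)
                eq = trans (cong (_+ n) (sym (m+[n∸m]≡n {n} {a} (<ᵇ-f⇒ {a} {n} ea)))) (trans (+-comm (n + (a ∸ n)) n) (sym (+-assoc n n (a ∸ n))))
    ... | false | false = inj₁ (sym (trans (sym (m∸n+n≡m {a} {n} (<ᵇ-f⇒ {a} {n} ea))) (trans (cong (_+ n) (suc-injective e)) (m∸n+n≡m {b} {n} (<ᵇ-f⇒ {b} {n} eb)))))

    -- The positions of the word encoded by the window start s and the choices ch:
    -- the word occupies the window [s, s+|ch|] and each choice says whether its
    -- first letter is the left (false) or the right (true) end of that window.
    positions : ℕ → List Bool → List ℕ
    positions s [] = s ∷ []
    positions s (false ∷ ch) = s ∷ positions (add s 1) ch
    positions s (true ∷ ch) = add s (suc (length ch)) ∷ positions s ch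

    decode : ℕ → List Bool → List ℤ
    decode s ch = map valAt (positions s ch)

    length-positions : ∀ s ch → length (positions s ch) ≡ suc (length ch)
    length-positions s [] = refl
    length-positions s (false ∷ ch) = cong suc (length-positions (add s 1) ch)
    length-positions s (true ∷ ch) = cong suc (length-positions s ch)

    positions-mem⇒ : ∀ {s x} ch → s < M → x ∈ positions s ch → Σ ℕ λ j → j ≤ length ch × x ≡ add s j
    positions-mem⇒ {s} [] s<M (here refl) = 0 , z≤n , sym (add-0 {s} s<M)
    positions-mem⇒ {s} (false ∷ ch) s<M (here refl) = 0 , z≤n , sym (add-0 {s} s<M)
    positions-mem⇒ {s} (false ∷ ch) s<M (there m) with positions-mem⇒ ch (add-lt s 1) m
    ... | j , j≤ , refl = suc j , s≤s j≤ , add-add s 1 j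
    positions-mem⇒ (true ∷ ch) s<M (here refl) = suc (length ch) , ≤-refl , refl
    positions-mem⇒ (true ∷ ch) s<M (there m) with positions-mem⇒ ch s<M m
    ... | j , j≤ , refl = j , m≤n⇒m≤1+n j≤ , refl

    positions-mem⇐ : ∀ {s j} ch → s < M → j ≤ length ch → add s j ∈ positions s ch
    positions-mem⇐ {s} [] s<M z≤n = here (add-0 {s} s<M)
    positions-mem⇐ {s} {zero} (false ∷ ch) s<M le = here (add-0 {s} s<M)
    positions-mem⇐ {s} {suc j} (false ∷ ch) s<M (s≤s le) =
      there (subst (_∈ positions (add s 1) ch) (add-add s 1 j) (positions-mem⇐ ch (add-lt s 1) le))
    positions-mem⇐ {s} {j} (true ∷ ch) s<M le with m≤n⇒m<n∨m≡n le
    ... | inj₁ (s≤s lt) = there (positions-mem⇐ ch s<M lt)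
    ... | inj₂ refl = here refl

    window-mem⇒ : ∀ {x s' L} → x ∈ window n s' L → Σ ℕ λ i → i < L × x ≡ add s' i
    window-mem⇒ {s' = s'} m with ∈-map⁻ (add s') m
    ... | i , mi , refl = i , ∈-upTo⁻ mi , refl

    window-mem⇐ : ∀ {s' L i} → i < L → add s' i ∈ window n s' L
    window-mem⇐ lt = ∈-map⁺ _ (∈-upTo⁺ lt)

    wide-circle : ∀ {k} → suc (suc k) ≤ n → k + k + 4 ≤ M
    wide-circle {k} le = subst (_≤ M) (eq k) (+-mono-≤ le le)
      where eq : ∀ k → suc (suc k) + suc (suc k) ≡ k + k + 4
            eq = NS.solve-∀

    extends : ℤ → List ℤ → Bool
    extends v w = not (elemᵇ ℤ.∣ v ∣ (map ℤ.∣_∣ w)) ∧ isInterval n (v ∷ w)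

    map-pos-decode : ∀ s ch → map (pos n) (decode s ch) ≡ positions s ch
    map-pos-decode s ch = trans (sym (LP.map-∘ (positions s ch))) (trans (LP.map-cong pos-valAt (positions s ch)) (LP.map-id (positions s ch)))

    isInterval-eq : ∀ p s ch → isInterval n (valAt p ∷ decode s ch) ≡
      anyᵇ (isWindowAt n (p ∷ positions s ch) (suc (suc (length ch)))) (upTo (n + n))
    isInterval-eq p s ch = cong₂ (λ P L → anyᵇ (isWindowAt n P L) (upTo (n + n)))
      (cong₂ _∷_ (pos-valAt p) (map-pos-decode s ch))
      (cong suc (trans (LP.length-map valAt (positions s ch)) (length-positions s ch)))

    elem-decode : ∀ {s p} ch → p ∈ positions s ch → elemᵇ ℤ.∣ valAt p ∣ (map ℤ.∣_∣ (decode s ch)) ≡ true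
    elem-decode ch m = elem⇐ (∈-map⁺ ℤ.∣_∣ (∈-map⁺ valAt m))

    module Extension (s : ℕ) (ch : List Bool) (s<M : s < M) (kn : suc (suc (length ch)) ≤ n) where
      k : ℕ
      k = length ch
      open TwoPointWindow k (wide-circle {k} kn)
      sk<M : suc k < M
      sk<M = ≤-trans kn (m≤m+n n n)
      j<M : ∀ {j} → j ≤ k → j < M
      j<M le = ≤-<-trans (≤-trans le (n≤1+n k)) sk<M
      k<n' : k < n'
      k<n' = ≤-pred kn
      k<M' : k < M'
      k<M' = ≤-trans k<n' (m≤m+n n' (suc n'))
      n'<M : n' < M
      n'<M = s≤s (m≤m+n n' (suc n'))

      fresh : ∀ p → (p ≡ add s M') ⊎ (p ≡ add s (suc k)) → elemᵇ ℤ.∣ valAt p ∣ (map ℤ.∣_∣ (decode s ch)) ≡ true → ⊥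
      fresh p hp e with ∈-map⁻ ℤ.∣_∣ (elem⇒ _ e)
      ... | z , zm , ze with ∈-map⁻ valAt zm
      ... | y , ym , refl with positions-mem⇒ ch s<M ym
      ... | j , j≤ , refl with hp
      ... | inj₁ refl with abs-valAt (add-lt s M') (add-lt s j) ze
      ... | inj₁ eq = <-irrefl refl (≤-<-trans (≤-reflexive (sym (add-inj (<⇒≤ s<M) (j<M j≤) ≤-refl eq))) (≤-<-trans j≤ k<M'))
      ... | inj₂ eq = <-irrefl refl (≤-<-trans (≤-reflexive (sym jn')) (≤-<-trans j≤ k<n'))
        where
          jn' : j ≡ n'
          jn' = add-inj (<⇒≤ s<M) (j<M j≤) n'<M
                  (trans eq (trans (add-add s M' n) (trans (sym (add-modr s (M' + n)))
                    (cong (add s) (trans (cong (_% M) (eqn n')) (%-wrap n' n'<M))))))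
            where eqn : ∀ n' → n' + suc n' + suc n' ≡ suc (n' + suc n') + n'
                  eqn = NS.solve-∀
      fresh p hp e | z , zm , ze | y , ym , refl | j , j≤ , refl | inj₂ refl with abs-valAt (add-lt s (suc k)) (add-lt s j) ze
      ... | inj₁ eq = <-irrefl refl (≤-<-trans (≤-reflexive (sym (add-inj (<⇒≤ s<M) (j<M j≤) sk<M eq))) (s≤s j≤))
      ... | inj₂ eq = <-irrefl refl (≤-<-trans (≤-reflexive (sym jk)) (≤-<-trans j≤ (s≤s (m≤m+n k n))))
        where
          lt : suc k + n < M
          lt = +-monoˡ-≤ n kn
          jk : j ≡ suc k + n
          jk = add-inj (<⇒≤ s<M) (j<M j≤) lt (trans eq (add-add s (suc k) n))

      right-interval : anyᵇ (isWindowAt n (add s (suc k) ∷ positions s ch) (suc (suc k))) (upTo (n + n)) ≡ true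
      right-interval = anyᵇ⇐ (upTo (n + n)) (∈-upTo⁺ s<M) (true-∧ (allᵇ⇐ _ f1) (allᵇ⇐ _ f2))
        where
          f1 : ∀ {x} → x ∈ (add s (suc k) ∷ positions s ch) → elemᵇ x (window n s (suc (suc k))) ≡ true
          f1 (here refl) = elem⇐ (window-mem⇐ {s} {suc (suc k)} {suc k} ≤-refl)
          f1 (there m) with positions-mem⇒ ch s<M m
          ... | j , j≤ , refl = elem⇐ (window-mem⇐ {s} {suc (suc k)} {j} (s≤s (≤-trans j≤ (n≤1+n k))))
          f2 : ∀ {x} → x ∈ window n s (suc (suc k)) → elemᵇ x (add s (suc k) ∷ positions s ch) ≡ true
          f2 m with window-mem⇒ {s' = s} m
          ... | i , i< , refl with m≤n⇒m<n∨m≡n (≤-pred i<)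
          ... | inj₁ lt = elem⇐ (there (positions-mem⇐ ch s<M (≤-pred lt)))
          ... | inj₂ refl = elem⇐ {add s (suc k)} {add s (suc k) ∷ positions s ch} (here refl)

      left-interval : anyᵇ (isWindowAt n (add s M' ∷ positions s ch) (suc (suc k))) (upTo (n + n)) ≡ true
      left-interval = anyᵇ⇐ (upTo (n + n)) (∈-upTo⁺ (add-lt s M')) (true-∧ (allᵇ⇐ _ f1) (allᵇ⇐ _ f2))
        where
          s' : ℕ
          s' = add s M'
          f1 : ∀ {x} → x ∈ (s' ∷ positions s ch) → elemᵇ x (window n s' (suc (suc k))) ≡ true
          f1 (here refl) = elem⇐ (subst (_∈ window n s' (suc (suc k))) (add-0 {s'} (add-lt s M')) (window-mem⇐ {s'} {suc (suc k)} {0} (s≤s z≤n)))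
          f1 (there m) with positions-mem⇒ ch s<M m
          ... | j , j≤ , refl = elem⇐ (subst (_∈ window n s' (suc (suc k))) (add-pred-suc s j) (window-mem⇐ {s'} {suc (suc k)} {suc j} (s≤s (s≤s j≤))))
          f2 : ∀ {x} → x ∈ window n s' (suc (suc k)) → elemᵇ x (s' ∷ positions s ch) ≡ true
          f2 m with window-mem⇒ {s' = s'} m
          ... | zero , i< , refl = elem⇐ {add s' 0} {s' ∷ positions s ch} (here (add-0 {s'} (add-lt s M')))
          ... | suc i , i< , refl = elem⇐ (there (subst (_∈ positions s ch) (sym (add-pred-suc s i)) (positions-mem⇐ ch s<M (≤-pred (≤-pred i<)))))

      -- Only the two neighbours s-1 and s+k+1 of the window [s, s+k] can be
      -- prepended: the new interval of k+2 points contains s and s+k, so in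
      -- coordinates relative to s it is a window through 0 and k.
      extends⇒ : ∀ p → p < M → extends (valAt p) (decode s ch) ≡ true → (p ≡ add s M') ⊎ (p ≡ add s (suc k))
      extends⇒ p p<M c with ∧-true {not (elemᵇ ℤ.∣ valAt p ∣ (map ℤ.∣_∣ (decode s ch)))} c
      ... | freshP , interval with anyᵇ⇒ (upTo (n + n)) (trans (sym (isInterval-eq p s ch)) interval)
      ... | s' , s'∈ , atS' = neighbour (window-through-0-and-k e d i₀ i₁ i₂ (add-lt s' (M ∸ s)) k<d
                               (≤-pred (proj₁ (proj₂ I0))) (≤-pred (proj₁ (proj₂ I1))) (≤-pred (proj₁ (proj₂ I2)))
                               (relative d (add-lt p (M ∸ s)) (proj₁ I0) (trans s⊕d (proj₂ (proj₂ I0))))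
                               (relative 0 (≤-<-trans z≤n s<M) (proj₁ I1) (proj₂ (proj₂ I1)))
                               (relative k (j<M ≤-refl) (proj₁ I2) (proj₂ (proj₂ I2))))
        where
          P : List ℕ
          P = p ∷ positions s ch
          inWindow : ∀ {x} → x ∈ P → Σ ℕ λ i → i < suc (suc k) × x ≡ add s' i
          inWindow m = window-mem⇒ {s' = s'} (elem⇒ _ (allᵇ⇒ P (proj₁ (∧-true {allᵇ (λ x → elemᵇ x (window n s' (suc (suc k)))) P} atS')) m))
          -- e and d are the window start s' and the point p measured from s
          e = add s' (M ∸ s)
          d : ℕ
          d = add p (M ∸ s)
          s⊕d : add s d ≡ p
          s⊕d = add-section (<⇒≤ s<M) p<M
          relative : ∀ y → y < M → ∀ i → add s y ≡ add s' i → y ≡ add e i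
          relative y y<M i eq = add-inj (<⇒≤ s<M) y<M (add-lt e i)
            (trans eq (trans (cong (λ z → add z i) (sym (add-section (<⇒≤ s<M) (∈-upTo⁻ s'∈))))
              (trans (add-add s e i) (sym (add-modr s (e + i))))))
          I0 : Σ ℕ λ i → i < suc (suc k) × p ≡ add s' i
          I0 = inWindow (here refl)
          I1 : Σ ℕ λ i → i < suc (suc k) × add s 0 ≡ add s' i
          I1 = inWindow (there (positions-mem⇐ {s} {0} ch s<M z≤n))
          I2 : Σ ℕ λ i → i < suc (suc k) × add s k ≡ add s' i
          I2 = inWindow (there (positions-mem⇐ {s} {k} ch s<M ≤-refl))
          i₀ : ℕ
          i₀ = proj₁ I0
          i₁ : ℕ
          i₁ = proj₁ I1
          i₂ : ℕ
          i₂ = proj₁ I2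
          -- d ≤ k would put p inside the word
          k<d : k < d
          k<d = ≰⇒> (λ d≤k → not-elim freshP (elem-decode ch (subst (_∈ positions s ch) s⊕d (positions-mem⇐ ch s<M d≤k))))
          neighbour : (d ≡ suc k) ⊎ (d ≡ M') → (p ≡ add s M') ⊎ (p ≡ add s (suc k))
          neighbour (inj₁ e1) = inj₂ (trans (sym s⊕d) (cong (add s) e1))
          neighbour (inj₂ e2) = inj₁ (trans (sym s⊕d) (cong (add s) e2))

      extends⇐ : ∀ p → (p ≡ add s M') ⊎ (p ≡ add s (suc k)) → extends (valAt p) (decode s ch) ≡ true
      extends⇐ p hp = true-∧ (not-true (fresh p hp)) (trans (isInterval-eq p s ch) (iv hp))
        where
          iv : (p ≡ add s M') ⊎ (p ≡ add s (suc k)) → anyᵇ (isWindowAt n (p ∷ positions s ch) (suc (suc k))) (upTo (n + n)) ≡ true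
          iv (inj₁ refl) = left-interval
          iv (inj₂ refl) = right-interval

      extends-iff : ∀ p → p < M → extends (valAt p) (decode s ch) ≡ ((p ≡ᵇ add s M') ∨ (p ≡ᵇ add s (suc k)))
      extends-iff p p<M = bool-ext
        (λ c → [ (λ e → subst (λ z → (z ∨ (p ≡ᵇ add s (suc k))) ≡ true) (sym (≡ᵇ-true e)) refl)
               , (λ e → trans (cong ((p ≡ᵇ add s M') ∨_) (≡ᵇ-true e)) (∨-zeroʳ _)) ]′ (extends⇒ p p<M c))
        (λ b → extends⇐ p ([ (λ h → inj₁ (≡ᵇ-≡ h)) , (λ h → inj₂ (≡ᵇ-≡ h)) ]′ (∨-true b)))
        where open import Data.Bool.Properties using (∨-zeroʳ)
              open import Data.Sum using ([_,_]′)


module Enumeration where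

  open import Defs
  open Sums
  open Reflection
  open CyclicArithmetic
  open Encoding
  open import Data.Nat as ℕ using (ℕ; _≤_; _<_; zero; suc; s≤s; _%_; _≡ᵇ_)
  open import Data.Integer as ℤ using (ℤ; +_; -[1+_]; _+_)
  open import Data.Bool using (Bool; true; false; _∧_; _∨_; not)
  open import Data.Bool.Properties using (∧-comm; ∧-commutativeMonoid)
  open import Data.List using (List; []; _∷_; map; length; upTo)
  open import Data.List.Membership.Propositional.Properties using (∈-upTo⁺)
  open import Data.List.Relation.Unary.Any using (here)
  open import Relation.Binary.PropositionalEquality using (_≡_; _≢_; refl; sym; trans; cong; cong₂; subst; module ≡-Reasoning)
  open import Data.Nat.DivMod using (n%n≡0)
  import Data.Nat.Properties as NP
  import Data.Integer.Properties as ZP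
  open import Algebra.Bundles using (CommutativeMonoid)
  open import Algebra.Properties.CommutativeSemigroup (CommutativeMonoid.commutativeSemigroup ∧-commutativeMonoid) using (interchange)

  sumBelow-pick2 : ∀ m a b (h : ℕ → ℤ) → a < m → b < m → a ≢ b →
    sumBelow m (λ p → when ((p ≡ᵇ a) ∨ (p ≡ᵇ b)) (h p)) ≡ h a + h b
  sumBelow-pick2 m a b h a<m b<m a≢b =
    trans (sumBelow-cong m (λ p _ → when-∨ (p ≡ᵇ a) (p ≡ᵇ b) (h p) (λ e1 e2 → a≢b (trans (sym (≡ᵇ-≡ {p} {a} e1)) (≡ᵇ-≡ {p} {b} e2)))))
      (trans (sumBelow-+ m (λ p → when (p ≡ᵇ a) (h p)) (λ p → when (p ≡ᵇ b) (h p)))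
        (cong₂ _+_ (sumBelow-pick m a h a<m) (sumBelow-pick m b h b<m)))

  module Count (n' : ℕ) where
    open Circle n'

    V : List ℤ
    V = signedVals n

    sum-signedVals : (F : ℤ → ℤ) → sumOver V F ≡ sumBelow M (λ p → F (valAt p))
    sum-signedVals F = begin
        sumOver V F
      ≡⟨ sumOver-++ (map (λ i → + suc i) (upTo n)) _ F ⟩
        sumOver (map (λ i → + suc i) (upTo n)) F + sumOver (map (λ i → -[1+ i ]) (upTo n)) F
      ≡⟨ cong₂ _+_ (trans (sumOver-map _ (upTo n) F) (sumOver-applyUpTo (λ i → i) n (λ i → F (+ suc i))))
                   (trans (sumOver-map _ (upTo n) F) (sumOver-applyUpTo (λ i → i) n (λ i → F -[1+ i ]))) ⟩
        sumBelow n (λ i → F (+ suc i)) + sumBelow n (λ i → F -[1+ i ])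
      ≡⟨ ZP.+-comm (sumBelow n (λ i → F (+ suc i))) (sumBelow n (λ i → F -[1+ i ])) ⟩
        sumBelow n (λ i → F -[1+ i ]) + sumBelow n (λ i → F (+ suc i))
      ≡⟨ cong₂ _+_ (sumBelow-cong n (λ i i<n → cong F (sym (negative i i<n)))) (sumBelow-cong n (λ i _ → cong F (sym (positive i)))) ⟩
        sumBelow n (λ p → F (valAt p)) + sumBelow n (λ i → F (valAt (n ℕ.+ i)))
      ≡⟨ sym (sumBelow-split n n (λ p → F (valAt p))) ⟩
        sumBelow M (λ p → F (valAt p)) ∎
      where
        open ≡-Reasoning
        negative : ∀ i → i < n → valAt i ≡ -[1+ i ]
        negative i lt rewrite <ᵇ-true lt = refl
        positive : ∀ i → valAt (n ℕ.+ i) ≡ + suc i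
        positive i rewrite <ᵇ-false {n ℕ.+ i} {n} (NP.m≤m+n n i) = cong (λ z → + suc z) (NP.m+n∸m≡n n i)

    sumBelow-rotate : (F : ℕ → ℤ) → sumBelow M (λ s → F (add s 1)) ≡ sumBelow M F
    sumBelow-rotate F = begin
        sumBelow M (λ s → F (add s 1))
      ≡⟨ sumBelow-snoc M' _ ⟩
        sumBelow M' (λ s → F (add s 1)) + F (add M' 1)
      ≡⟨ cong₂ _+_ (sumBelow-cong M' (λ s s<M' → cong F (trans (add-small {s} {1} (s≤s (NP.≤-trans (NP.≤-reflexive (NP.+-comm s 1)) s<M'))) (NP.+-comm s 1))))
                   (cong F (trans (cong (_% M) (NP.+-comm M' 1)) (n%n≡0 M))) ⟩
        sumBelow M' (λ s → F (suc s)) + F 0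
      ≡⟨ ZP.+-comm (sumBelow M' (λ s → F (suc s))) (F 0) ⟩
        sumBelow M F ∎
      where open ≡-Reasoning

    isInterval-single : ∀ p → p < M → isInterval n (valAt p ∷ []) ≡ true
    isInterval-single p p<M rewrite pos-valAt p =
      anyᵇ⇐ (upTo (n ℕ.+ n)) (∈-upTo⁺ p<M)
        (true-∧ (true-∧ (elem⇐ {p} {window n p 1} (here (sym (add-0 {p} p<M)))) refl)
                (true-∧ (elem⇐ {add p 0} {p ∷ []} (here (add-0 {p} p<M))) refl))

    isSignedArc : List ℤ → Bool
    isSignedArc w = isSignedPerm w ∧ isBArc n w

    isSignedArc-cons : ∀ v w → isSignedArc (v ∷ w) ≡ isSignedArc w ∧ extends v w
    isSignedArc-cons v w =
      trans (interchange (not (elemᵇ ℤ.∣ v ∣ (map ℤ.∣_∣ w))) (isSignedPerm w) (isInterval n (v ∷ w)) (isBArc n w))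
            (∧-comm (extends v w) (isSignedArc w))

    sum-extensions : ∀ s ch → s < M → suc (suc (length ch)) ≤ n → (g : List ℤ → ℤ) →
      sumOver V (λ v → when (extends v (decode s ch)) (g (v ∷ decode s ch)))
        ≡ g (valAt (add s M') ∷ decode s ch) + g (valAt (add s (suc (length ch))) ∷ decode s ch)
    sum-extensions s ch s<M kn g =
      trans (sum-signedVals (λ v → when (extends v (decode s ch)) (g (v ∷ decode s ch))))
      (trans (sumBelow-cong M (λ p p<M → cong (λ b → when b (g (valAt p ∷ decode s ch))) (Extension.extends-iff s ch s<M kn p p<M)))
             (sumBelow-pick2 M (add s M') (add s (suc (length ch))) (λ p → g (valAt p ∷ decode s ch)) (add-lt s M') (add-lt s _) distinct))
      where
        distinct : add s M' ≢ add s (suc (length ch))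
        distinct e = NP.<-irrefl (sym (add-inj {s} {M'} {suc (length ch)} (NP.<⇒≤ s<M) NP.≤-refl (NP.≤-trans kn (NP.m≤m+n n n)) e))
                                 (NP.≤-trans kn (NP.m≤n+m n n'))

    peel-first : ∀ k (g : List ℤ → ℤ) →
      sumOver (words V (suc (suc k))) (λ w → when (isSignedArc w) (g w))
        ≡ sumOver (words V (suc k)) (λ w → when (isSignedArc w) (sumOver V (λ v → when (extends v w) (g (v ∷ w)))))
    peel-first k g = begin
        sumOver (words V (suc (suc k))) (λ w → when (isSignedArc w) (g w))
      ≡⟨ sumOver-concatMap (λ v → map (v ∷_) (words V (suc k))) V (λ w → when (isSignedArc w) (g w)) ⟩
        sumOver V (λ v → sumOver (map (v ∷_) (words V (suc k))) (λ w → when (isSignedArc w) (g w)))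
      ≡⟨ sumOver-cong V (λ v → sumOver-map (v ∷_) (words V (suc k)) _) ⟩
        sumOver V (λ v → sumOver (words V (suc k)) (λ w → when (isSignedArc (v ∷ w)) (g (v ∷ w))))
      ≡⟨ sumOver-cong V (λ v → sumOver-cong (words V (suc k)) (λ w →
           trans (cong (λ b → when b (g (v ∷ w))) (isSignedArc-cons v w)) (when-∧ (isSignedArc w) (extends v w) (g (v ∷ w))))) ⟩
        sumOver V (λ v → sumOver (words V (suc k)) (λ w → when (isSignedArc w) (when (extends v w) (g (v ∷ w)))))
      ≡⟨ sumOver-swap V (words V (suc k)) _ ⟩
        sumOver (words V (suc k)) (λ w → sumOver V (λ v → when (isSignedArc w) (when (extends v w) (g (v ∷ w)))))
      ≡⟨ sumOver-cong (words V (suc k)) (λ w → sym (when-sumOver (isSignedArc w) V _)) ⟩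
        sumOver (words V (suc k)) (λ w → when (isSignedArc w) (sumOver V (λ v → when (extends v w) (g (v ∷ w))))) ∎
      where open ≡-Reasoning

    -- Prepending the left neighbour s-1 to the word of (s, ch) gives the word of
    -- (s-1, false ∷ ch); after rotating s this is the "false" half of the choices.
    left-extensions : ∀ k (g : List ℤ → ℤ) →
      sumBelow M (λ s → sumOver (choices k) (λ ch → g (valAt (add s M') ∷ decode s ch)))
        ≡ sumBelow M (λ s → sumOver (choices k) (λ ch → g (decode s (false ∷ ch))))
    left-extensions k g = trans (sym (sumBelow-rotate (λ s → sumOver (choices k) (λ ch → g (valAt (add s M') ∷ decode s ch)))))
      (sumBelow-cong M (λ s s<M → sumOver-cong (choices k) (λ ch →
        cong (λ z → g (valAt z ∷ decode (add s 1) ch)) (trans (add-add s 1 M') (add-M s<M)))))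

    right-extensions : ∀ k s (g : List ℤ → ℤ) →
      sumOver (choices k) (λ ch → g (valAt (add s (suc k)) ∷ decode s ch))
        ≡ sumOver (choices k) (λ ch → g (decode s (true ∷ ch)))
    right-extensions k s g = sumOver-choices-cong k (λ ch l → cong (λ z → g (valAt (add s (suc z)) ∷ decode s ch)) (sym l))

    sum-arcWords : ∀ k → suc k ≤ n → (g : List ℤ → ℤ) →
      sumOver (words V (suc k)) (λ w → when (isSignedArc w) (g w)) ≡ sumBelow M (λ s → sumOver (choices k) (λ ch → g (decode s ch)))
    sum-arcWords zero le g =
      trans (sumOver-concatMap (λ v → map (v ∷_) (words V 0)) V (λ w → when (isSignedArc w) (g w)))
      (trans (sum-signedVals (λ v → when (isSignedArc (v ∷ [])) (g (v ∷ [])) + + 0))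
             (sumBelow-cong M (λ p p<M → cong (λ b → when (true ∧ (b ∧ true)) (g (valAt p ∷ [])) + + 0) (isInterval-single p p<M))))
    sum-arcWords (suc k) le g = begin
        sumOver (words V (suc (suc k))) (λ w → when (isSignedArc w) (g w))
      ≡⟨ peel-first k g ⟩
        sumOver (words V (suc k)) (λ w → when (isSignedArc w) (sumOver V (λ v → when (extends v w) (g (v ∷ w)))))
      ≡⟨ sum-arcWords k (NP.≤-trans (NP.n≤1+n _) le) (λ w → sumOver V (λ v → when (extends v w) (g (v ∷ w)))) ⟩
        sumBelow M (λ s → sumOver (choices k) (λ ch → sumOver V (λ v → when (extends v (decode s ch)) (g (v ∷ decode s ch)))))
      ≡⟨ sumBelow-cong M (λ s s<M → sumOver-choices-cong k (λ ch l →
           trans (sum-extensions s ch s<M (subst (λ z → suc (suc z) ≤ n) (sym l) le) g)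
                 (cong (λ z → left s ch + g (valAt (add s (suc z)) ∷ decode s ch)) l))) ⟩
        sumBelow M (λ s → sumOver (choices k) (λ ch → left s ch + right s ch))
      ≡⟨ sumBelow-cong M (λ s _ → sumOver-+ (choices k) (left s) (right s)) ⟩
        sumBelow M (λ s → sumOver (choices k) (left s) + sumOver (choices k) (right s))
      ≡⟨ sumBelow-+ M (λ s → sumOver (choices k) (left s)) (λ s → sumOver (choices k) (right s)) ⟩
        sumBelow M (λ s → sumOver (choices k) (left s)) + sumBelow M (λ s → sumOver (choices k) (right s))
      ≡⟨ cong₂ _+_ (left-extensions k g) (sumBelow-cong M (λ s _ → right-extensions k s g)) ⟩
        sumBelow M (λ s → sumOver (choices k) (λ ch → g (decode s (false ∷ ch))))
          + sumBelow M (λ s → sumOver (choices k) (λ ch → g (decode s (true ∷ ch))))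
      ≡⟨ sym (sumBelow-+ M (λ s → sumOver (choices k) (λ ch → g (decode s (false ∷ ch)))) (λ s → sumOver (choices k) (λ ch → g (decode s (true ∷ ch))))) ⟩
        sumBelow M (λ s → sumOver (choices k) (λ ch → g (decode s (false ∷ ch))) + sumOver (choices k) (λ ch → g (decode s (true ∷ ch))))
      ≡⟨ sumBelow-cong M (λ s _ → sym (sumOver-choices k (λ ch → g (decode s ch)))) ⟩
        sumBelow M (λ s → sumOver (choices (suc k)) (λ ch → g (decode s ch))) ∎
      where
        open ≡-Reasoning
        left right : ℕ → List Bool → ℤ
        left s ch = g (valAt (add s M') ∷ decode s ch)
        right s ch = g (valAt (add s (suc k)) ∷ decode s ch)

module Statistics where

  open import Defs
  open import Data.Nat as ℕ using (ℕ; zero; suc; _<ᵇ_)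
  open import Data.Integer using (ℤ; +_; _+_; _*_; _^_)
  open import Data.Bool using (Bool; true; false; if_then_else_)
  open import Data.List using (List; []; _∷_; map; length; _++_; foldr)
  open import Relation.Binary.PropositionalEquality using (_≡_; refl; sym; trans; cong; cong₂; module ≡-Reasoning)
  import Data.Nat.Properties as NP
  import Data.List.Properties as LP
  import Data.Integer.Properties as ZP
  open import Data.Integer.Properties using (^-distribˡ-+-*)
  import Data.Nat.Tactic.RingSolver as NS
  open import Data.Integer.Tactic.RingSolver using (solve-∀)

  bit : Bool → ℕ
  bit b = if b then 1 else 0

  ^-distribʳ-* : ∀ (x y : ℤ) k → (x * y) ^ k ≡ x ^ k * y ^ k
  ^-distribʳ-* x y zero = refl
  ^-distribʳ-* x y (suc k) = trans (cong (x * y *_) (^-distribʳ-* x y k)) (lem x y (x ^ k) (y ^ k))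
    where lem : ∀ (x y a b : ℤ) → x * y * (a * b) ≡ x * a * (y * b)
          lem = solve-∀

  module Recurrences (n : ℕ) where
    descents-shift : ∀ i w → descentPositions n (suc i) w ≡ map suc (descentPositions n i w)
    descents-shift i [] = refl
    descents-shift i (x ∷ []) = refl
    descents-shift i (x ∷ y ∷ ys) = trans (cong₂ _++_ (shift-one (pos n y <ᵇ pos n x)) (descents-shift (suc i) (y ∷ ys)))
        (sym (LP.map-++ suc (if pos n y <ᵇ pos n x then i ∷ [] else []) (descentPositions n (suc i) (y ∷ ys))))
      where shift-one : ∀ b → (if b then suc i ∷ [] else []) ≡ map suc (if b then i ∷ [] else [])
            shift-one true = refl
            shift-one false = refl

    sum-map-suc : ∀ xs → foldr ℕ._+_ 0 (map suc xs) ≡ foldr ℕ._+_ 0 xs ℕ.+ length xs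
    sum-map-suc [] = refl
    sum-map-suc (x ∷ xs) = trans (cong (λ r → suc (x ℕ.+ r)) (sum-map-suc xs)) (lem x (foldr ℕ._+_ 0 xs) (length xs))
      where lem : ∀ x F L → suc (x ℕ.+ (F ℕ.+ L)) ≡ x ℕ.+ F ℕ.+ suc L
            lem = NS.solve-∀

    des-cons : ∀ v y ys → des n (v ∷ y ∷ ys) ≡ bit (pos n y <ᵇ pos n v) ℕ.+ des n (y ∷ ys)
    des-cons v y ys with pos n y <ᵇ pos n v
    ... | true = cong suc (trans (cong length (descents-shift 1 (y ∷ ys))) (LP.length-map suc (descentPositions n 1 (y ∷ ys))))
    ... | false = trans (cong length (descents-shift 1 (y ∷ ys))) (LP.length-map suc (descentPositions n 1 (y ∷ ys)))

    -- prepending shifts every old descent one place to the right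
    maj-cons : ∀ v y ys → maj n (v ∷ y ∷ ys) ≡ bit (pos n y <ᵇ pos n v) ℕ.+ (maj n (y ∷ ys) ℕ.+ des n (y ∷ ys))
    maj-cons v y ys with pos n y <ᵇ pos n v
    ... | true = cong suc (trans (cong (foldr ℕ._+_ 0) (descents-shift 1 (y ∷ ys))) (sum-map-suc (descentPositions n 1 (y ∷ ys))))
    ... | false = trans (cong (foldr ℕ._+_ 0) (descents-shift 1 (y ∷ ys))) (sum-map-suc (descentPositions n 1 (y ∷ ys)))

    neg-cons : ∀ v w → neg (v ∷ w) ≡ bit (isNeg v) ℕ.+ neg w
    neg-cons v w with isNeg v
    ... | true = refl
    ... | false = refl

  -- the weight x^(2 des w) q^(2 maj w + neg w); at x = t it is t^fdes q^fmaj up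
  -- to the factor t^[w(1) < 0]
  module Weight (n : ℕ) (q : ℤ) where
    open Recurrences n

    weight : ℤ → List ℤ → ℤ
    weight x w = x ^ (2 ℕ.* des n w) * q ^ (2 ℕ.* maj n w ℕ.+ neg w)

    weight-shift : ∀ (x : ℤ) c D Mj N → x ^ (2 ℕ.* D) * q ^ (2 ℕ.* (Mj ℕ.+ D) ℕ.+ (c ℕ.+ N))
         ≡ q ^ c * ((x * q) ^ (2 ℕ.* D) * q ^ (2 ℕ.* Mj ℕ.+ N))
    weight-shift x c D Mj N = begin
        x ^ (2 ℕ.* D) * q ^ (2 ℕ.* (Mj ℕ.+ D) ℕ.+ (c ℕ.+ N))
      ≡⟨ cong (λ e → x ^ (2 ℕ.* D) * q ^ e) (exponent c D Mj N) ⟩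
        x ^ (2 ℕ.* D) * q ^ (2 ℕ.* D ℕ.+ (c ℕ.+ (2 ℕ.* Mj ℕ.+ N)))
      ≡⟨ cong (x ^ (2 ℕ.* D) *_) (trans (^-distribˡ-+-* q (2 ℕ.* D) _) (cong (q ^ (2 ℕ.* D) *_) (^-distribˡ-+-* q c _))) ⟩
        x ^ (2 ℕ.* D) * (q ^ (2 ℕ.* D) * (q ^ c * q ^ (2 ℕ.* Mj ℕ.+ N)))
      ≡⟨ lem (x ^ (2 ℕ.* D)) (q ^ (2 ℕ.* D)) (q ^ c) (q ^ (2 ℕ.* Mj ℕ.+ N)) ⟩
        q ^ c * (x ^ (2 ℕ.* D) * q ^ (2 ℕ.* D) * q ^ (2 ℕ.* Mj ℕ.+ N))
      ≡⟨ cong (λ z → q ^ c * (z * q ^ (2 ℕ.* Mj ℕ.+ N))) (sym (^-distribʳ-* x q (2 ℕ.* D))) ⟩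
        q ^ c * ((x * q) ^ (2 ℕ.* D) * q ^ (2 ℕ.* Mj ℕ.+ N)) ∎
      where
        open ≡-Reasoning
        exponent : ∀ c D Mj N → 2 ℕ.* (Mj ℕ.+ D) ℕ.+ (c ℕ.+ N) ≡ 2 ℕ.* D ℕ.+ (c ℕ.+ (2 ℕ.* Mj ℕ.+ N))
        exponent = NS.solve-∀
        lem : ∀ (X Q C R : ℤ) → X * (Q * (C * R)) ≡ C * (X * Q * R)
        lem = solve-∀

    weight-step : ∀ (x : ℤ) b c D Mj N → x ^ (2 ℕ.* (bit b ℕ.+ D)) * q ^ (2 ℕ.* (bit b ℕ.+ (Mj ℕ.+ D)) ℕ.+ (c ℕ.+ N))
         ≡ (if b then x * x * (q * q) else + 1) * q ^ c * ((x * q) ^ (2 ℕ.* D) * q ^ (2 ℕ.* Mj ℕ.+ N))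
    weight-step x false c D Mj N =
      trans (weight-shift x c D Mj N) (cong (_* ((x * q) ^ (2 ℕ.* D) * q ^ (2 ℕ.* Mj ℕ.+ N))) (sym (ZP.*-identityˡ (q ^ c))))
    weight-step x true c D Mj N = begin
        x ^ (2 ℕ.* suc D) * q ^ (2 ℕ.* suc (Mj ℕ.+ D) ℕ.+ (c ℕ.+ N))
      ≡⟨ cong₂ (λ a b → x ^ a * q ^ b) (two-more D) (two-more′ D Mj (c ℕ.+ N)) ⟩
        x * (x * x ^ (2 ℕ.* D)) * (q * (q * q ^ (2 ℕ.* (Mj ℕ.+ D) ℕ.+ (c ℕ.+ N))))
      ≡⟨ lem x q (x ^ (2 ℕ.* D)) (q ^ (2 ℕ.* (Mj ℕ.+ D) ℕ.+ (c ℕ.+ N))) ⟩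
        x * x * (q * q) * (x ^ (2 ℕ.* D) * q ^ (2 ℕ.* (Mj ℕ.+ D) ℕ.+ (c ℕ.+ N)))
      ≡⟨ cong (x * x * (q * q) *_) (weight-shift x c D Mj N) ⟩
        x * x * (q * q) * (q ^ c * ((x * q) ^ (2 ℕ.* D) * q ^ (2 ℕ.* Mj ℕ.+ N)))
      ≡⟨ sym (ZP.*-assoc (x * x * (q * q)) (q ^ c) _) ⟩
        x * x * (q * q) * q ^ c * ((x * q) ^ (2 ℕ.* D) * q ^ (2 ℕ.* Mj ℕ.+ N)) ∎
      where
        open ≡-Reasoning
        two-more : ∀ D → 2 ℕ.* suc D ≡ suc (suc (2 ℕ.* D))
        two-more = NS.solve-∀
        two-more′ : ∀ D Mj R → 2 ℕ.* suc (Mj ℕ.+ D) ℕ.+ R ≡ suc (suc (2 ℕ.* (Mj ℕ.+ D) ℕ.+ R))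
        two-more′ = NS.solve-∀
        lem : ∀ (x q X Q : ℤ) → x * (x * X) * (q * (q * Q)) ≡ x * x * (q * q) * (X * Q)
        lem = solve-∀

    -- prepending v to y ∷ ys: a factor for the new pair and for the sign of v,
    -- while the rest is weighted with x q in place of x (maj shifts by des)
    weight-cons : ∀ x v y ys → weight x (v ∷ y ∷ ys) ≡
      (if pos n y <ᵇ pos n v then x * x * (q * q) else + 1) * q ^ bit (isNeg v) * weight (x * q) (y ∷ ys)
    weight-cons x v y ys rewrite des-cons v y ys | maj-cons v y ys | neg-cons v (y ∷ ys) =
      weight-step x (pos n y <ᵇ pos n v) (bit (isNeg v)) (des n (y ∷ ys)) (maj n (y ∷ ys)) (neg (y ∷ ys))

    weight-single : ∀ x v → weight x (v ∷ []) ≡ q ^ bit (isNeg v)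
    weight-single x v rewrite neg-cons v [] = trans (ZP.*-identityˡ _) (cong (q ^_) (NP.+-identityʳ (bit (isNeg v))))

module Windows (n' : ℕ) (q : ℤ) where

  open import Defs
  open Sums
  open Reflection
  open CyclicArithmetic
  open Encoding
  open Statistics
  open import Data.Nat as ℕ using (ℕ; _≤_; _<_; zero; suc; _∸_; z≤n; s≤s; _%_; _<ᵇ_)
  open import Data.Integer using (ℤ; +_; _+_; _*_; _^_)
  open import Relation.Nullary using (yes; no)
  open import Data.Bool using (Bool; true; false; if_then_else_)
  open import Data.List using (List; []; _∷_; length)
  open import Data.Nat.DivMod using (n%n≡0)
  open import Relation.Binary.PropositionalEquality using (_≡_; refl; sym; trans; cong; cong₂; subst; module ≡-Reasoning)
  import Data.Nat.Properties as NP
  import Data.Integer.Properties as ZP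
  open import Data.Integer.Properties using (^-distribˡ-+-*)
  import Data.Nat.Tactic.RingSolver as NS
  open import Data.Integer.Tactic.RingSolver using (solve-∀)

  open Circle n'
  open Weight n q public

  -- evenProd k y = Π_{i=1}^{k} (1 + y² q^{2i})
  evenProd : ℕ → ℤ → ℤ
  evenProd zero y = + 1
  evenProd (suc k) y = (+ 1 + y * y * (q * q)) * evenProd k (y * q)

  negatives : ℕ → ℕ → ℕ
  negatives s zero = 0
  negatives s (suc L) = bit (s <ᵇ n) ℕ.+ negatives (suc s) L

  negatives-snoc : ∀ L s → negatives s (suc L) ≡ negatives s L ℕ.+ bit (s ℕ.+ L <ᵇ n)
  negatives-snoc zero s rewrite NP.+-identityʳ s = NP.+-comm (bit (s <ᵇ n)) 0
  negatives-snoc (suc L) s rewrite negatives-snoc L (suc s) | NP.+-suc s L =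
    sym (NP.+-assoc (bit (s <ᵇ n)) (negatives (suc s) L) _)

  negatives-none : ∀ L s → n ≤ s → negatives s L ≡ 0
  negatives-none zero s le = refl
  negatives-none (suc L) s le rewrite <ᵇ-false {s} {n} le = negatives-none L (suc s) (NP.≤-trans le (NP.n≤1+n s))

  negatives-all : ∀ L s → s ℕ.+ L ≤ n → negatives s L ≡ L
  negatives-all zero s le = refl
  negatives-all (suc L) s le rewrite <ᵇ-true {s} {n} (NP.≤-trans (NP.≤-trans (s≤s (NP.m≤m+n s L)) (NP.≤-reflexive (sym (NP.+-suc s L)))) le) =
    cong suc (negatives-all L (suc s) (NP.≤-trans (NP.≤-reflexive (sym (NP.+-suc s L))) le))

  negatives-partial : ∀ L s → s ≤ n → n ∸ s ≤ L → negatives s L ≡ n ∸ s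
  negatives-partial zero s s≤n le = sym (NP.n≤0⇒n≡0 le)
  negatives-partial (suc L) s s≤n le with s ℕ.<? n
  ... | yes s<n = trans (cong (λ b → bit b ℕ.+ negatives (suc s) L) (<ᵇ-true {s} {n} s<n))
        (trans (cong suc (negatives-partial L (suc s) s<n (NP.≤-pred (subst (ℕ._≤ suc L) e le)))) (sym e))
    where e : n ∸ s ≡ suc (n ∸ suc s)
          e = NP.+-∸-assoc 1 {n} {suc s} s<n
  ... | no s≮n = trans (negatives-none (suc L) s (NP.≮⇒≥ s≮n)) (sym (NP.m≤n⇒m∸n≡0 (NP.≮⇒≥ s≮n)))

  headOffset : List Bool → ℕ
  headOffset [] = 0
  headOffset (false ∷ _) = 0
  headOffset (true ∷ ch) = suc (length ch)

  headOffset-≤ : ∀ ch → headOffset ch ≤ length ch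
  headOffset-≤ [] = z≤n
  headOffset-≤ (false ∷ ch) = z≤n
  headOffset-≤ (true ∷ ch) = NP.≤-refl

  headPos : ℕ → List Bool → ℕ
  headPos s [] = s
  headPos s (false ∷ _) = s
  headPos s (true ∷ ch) = add s (suc (length ch))

  headPos-flat : ∀ s ch → s ℕ.+ length ch < M → headPos s ch ≡ s ℕ.+ headOffset ch
  headPos-flat s [] _ = sym (NP.+-identityʳ s)
  headPos-flat s (false ∷ _) _ = sym (NP.+-identityʳ s)
  headPos-flat s (true ∷ ch) lt = add-small {s} {suc (length ch)} lt

  weight-decode : ∀ x p s ch → weight x (valAt p ∷ decode s ch) ≡
    (if headPos s ch <ᵇ p then x * x * (q * q) else + 1) * q ^ bit (p <ᵇ n) * weight (x * q) (decode s ch)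
  weight-decode x p s [] rewrite weight-cons x (valAt p) (valAt s) [] | pos-valAt s | pos-valAt p | isNeg-valAt p = refl
  weight-decode x p s (false ∷ ch) rewrite weight-cons x (valAt p) (valAt s) (decode (add s 1) ch) | pos-valAt s | pos-valAt p | isNeg-valAt p = refl
  weight-decode x p s (true ∷ ch)
    rewrite weight-cons x (valAt p) (valAt (add s (suc (length ch)))) (decode s ch) | pos-valAt (add s (suc (length ch))) | pos-valAt p | isNeg-valAt p = refl

  prependFactor : ℤ → Bool → ℕ → ℤ
  prependFactor x c p = (if c then x * x * (q * q) else + 1) * q ^ bit (p <ᵇ n)

  sumLeft sumRight sumAll : ℕ → ℕ → ℤ → ℤ
  sumLeft s k x = sumOver (choices k) (λ ch → weight x (decode s (false ∷ ch)))
  sumRight s k x = sumOver (choices k) (λ ch → weight x (decode s (true ∷ ch)))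
  sumAll s k x = sumOver (choices k) (λ ch → weight x (decode s ch))

  sumAll-split : ∀ s k x → sumAll s (suc k) x ≡ sumLeft s k x + sumRight s k x
  sumAll-split s k x = sumOver-choices k (λ ch → weight x (decode s ch))

  sum-prepend : ∀ k x p s (φ : List Bool → List Bool) c → (∀ ch → length ch ≡ k → (headPos s (φ ch) <ᵇ p) ≡ c) →
    sumOver (choices k) (λ ch → weight x (valAt p ∷ decode s (φ ch))) ≡
    prependFactor x c p * sumOver (choices k) (λ ch → weight (x * q) (decode s (φ ch)))
  sum-prepend k x p s φ c h =
    trans (sumOver-choices-cong k (λ ch l → trans (weight-decode x p s (φ ch))
             (cong (λ b → prependFactor x b p * weight (x * q) (decode s (φ ch))) (h ch l))))
          (sym (sumOver-*ˡ (prependFactor x c p) (choices k) (λ ch → weight (x * q) (decode s (φ ch)))))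

  prepend-split : ∀ k x p s cL cR →
    (∀ ch → length ch ≡ k → (headPos s (false ∷ ch) <ᵇ p) ≡ cL) →
    (∀ ch → length ch ≡ k → (headPos s (true ∷ ch) <ᵇ p) ≡ cR) →
    sumOver (choices (suc k)) (λ ch → weight x (valAt p ∷ decode s ch)) ≡
    prependFactor x cL p * sumLeft s k (x * q) + prependFactor x cR p * sumRight s k (x * q)
  prepend-split k x p s cL cR hL hR = trans (sumOver-choices k (λ ch → weight x (valAt p ∷ decode s ch)))
    (cong₂ _+_ (sum-prepend k x p s (false ∷_) cL hL) (sum-prepend k x p s (true ∷_) cR hR))

  -- the right choice prepends s+k+1, a position independent of the choices
  sumRight-const : ∀ s k x r c → add s (suc k) ≡ r → (∀ ch → length ch ≡ k → (headPos s ch <ᵇ r) ≡ c) →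
    sumRight s k x ≡ prependFactor x c r * sumAll s k (x * q)
  sumRight-const s k x r c eq h =
    trans (sumOver-choices-cong k (λ ch l → cong (λ p → weight x (valAt p ∷ decode s ch)) (trans (cong (λ j → add s (suc j)) l) eq)))
          (sum-prepend k x r s (λ ch → ch) c h)

  -- Windows [s, s+k+1] that do not wrap around: the left end is below and the
  -- right end above every other letter.
  sumLeft-flat : ∀ s k x → s ℕ.+ suc k < M → sumLeft s k x ≡ + 1 * q ^ bit (s <ᵇ n) * sumAll (suc s) k (x * q)
  sumLeft-flat s k x lt = trans (cong (λ t → sumOver (choices k) (λ ch → weight x (valAt s ∷ decode t ch))) s⊕1)
      (sum-prepend k x s (suc s) (λ ch → ch) false noDescent)
    where
      s⊕1 : add s 1 ≡ suc s
      s⊕1 = trans (add-small {s} {1} (NP.≤-<-trans (NP.+-monoʳ-≤ s (s≤s z≤n)) lt)) (NP.+-comm s 1)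
      noDescent : ∀ ch → length ch ≡ k → (headPos (suc s) ch <ᵇ s) ≡ false
      noDescent ch l = <ᵇ-false (NP.≤-trans (NP.n≤1+n s) (NP.≤-trans (NP.m≤m+n (suc s) (headOffset ch))
          (NP.≤-reflexive (sym (headPos-flat (suc s) ch fits)))))
        where fits : suc s ℕ.+ length ch < M
              fits = subst (λ j → suc s ℕ.+ j < M) (sym l) (NP.≤-trans (NP.≤-reflexive (cong suc (sym (NP.+-suc s k)))) lt)

  sumRight-flat : ∀ s k x → s ℕ.+ suc k < M → sumRight s k x ≡ x * x * (q * q) * q ^ bit (s ℕ.+ suc k <ᵇ n) * sumAll s k (x * q)
  sumRight-flat s k x lt = sumRight-const s k x (s ℕ.+ suc k) true (add-small {s} {suc k} lt) descent
    where
      descent : ∀ ch → length ch ≡ k → (headPos s ch <ᵇ s ℕ.+ suc k) ≡ true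
      descent ch l = <ᵇ-true (NP.≤-<-trans (NP.≤-reflexive (headPos-flat s ch fits))
          (NP.+-monoʳ-< s (s≤s (NP.≤-trans (headOffset-≤ ch) (NP.≤-reflexive l)))))
        where fits : s ℕ.+ length ch < M
              fits = subst (λ j → s ℕ.+ j < M) (sym l) (NP.≤-<-trans (NP.+-monoʳ-≤ s (NP.n≤1+n k)) lt)

  sumAll-flat : ∀ k s x → s ℕ.+ k < M → sumAll s k x ≡ q ^ negatives s (suc k) * evenProd k x
  sumAll-flat zero s x lt = trans (ZP.+-identityʳ _) (trans (weight-single x (valAt s))
    (trans (cong (λ b → q ^ bit b) (isNeg-valAt s)) (trans (cong (q ^_) (sym (NP.+-identityʳ (bit (s <ᵇ n))))) (sym (ZP.*-identityʳ _)))))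
  sumAll-flat (suc k) s x lt = begin
      sumAll s (suc k) x
    ≡⟨ sumAll-split s k x ⟩
      sumLeft s k x + sumRight s k x
    ≡⟨ cong₂ _+_ (sumLeft-flat s k x lt) (sumRight-flat s k x lt) ⟩
      + 1 * q ^ b * sumAll (suc s) k (x * q) + x * x * (q * q) * q ^ b' * sumAll s k (x * q)
    ≡⟨ cong₂ (λ u v → + 1 * q ^ b * u + x * x * (q * q) * q ^ b' * v)
         (sumAll-flat k (suc s) (x * q) (NP.≤-trans (NP.≤-reflexive (cong suc (sym (NP.+-suc s k)))) lt))
         (sumAll-flat k s (x * q) (NP.≤-<-trans (NP.+-monoʳ-≤ s (NP.n≤1+n k)) lt)) ⟩
      + 1 * q ^ b * (q ^ negatives (suc s) (suc k) * E) + x * x * (q * q) * q ^ b' * (q ^ negatives s (suc k) * E)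
    ≡⟨ regroup (q ^ b) (q ^ b') (q ^ negatives (suc s) (suc k)) (q ^ negatives s (suc k)) (x * x * (q * q)) E ⟩
      q ^ b * q ^ negatives (suc s) (suc k) * E + x * x * (q * q) * (q ^ negatives s (suc k) * q ^ b') * E
    ≡⟨ cong₂ (λ u v → u * E + x * x * (q * q) * v * E)
         (sym (^-distribˡ-+-* q b (negatives (suc s) (suc k))))
         (trans (sym (^-distribˡ-+-* q (negatives s (suc k)) b')) (cong (q ^_) (sym (negatives-snoc (suc k) s)))) ⟩
      q ^ negatives s (suc (suc k)) * E + x * x * (q * q) * q ^ negatives s (suc (suc k)) * E
    ≡⟨ factor (q ^ negatives s (suc (suc k))) E (x * x * (q * q)) ⟩
      q ^ negatives s (suc (suc k)) * evenProd (suc k) x ∎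
    where
      open ≡-Reasoning
      b : ℕ
      b = bit (s <ᵇ n)
      b' : ℕ
      b' = bit (s ℕ.+ suc k <ᵇ n)
      E : ℤ
      E = evenProd k (x * q)
      regroup : ∀ (B B′ N N′ X F : ℤ) → + 1 * B * (N * F) + X * B′ * (N′ * F) ≡ B * N * F + X * (N′ * B′) * F
      regroup = solve-∀
      factor : ∀ (A C X : ℤ) → A * C + X * A * C ≡ A * ((+ 1 + X) * C)
      factor = solve-∀

  -- Wrapping windows start at M - (a+1) and cover a+1 positive and b+1 negative
  -- positions; their sums satisfy the recursion of wrapSum.
  wrapSum : ℕ → ℕ → ℤ → ℤ
  wrapSum zero zero y = + 0
  wrapSum zero (suc b) y = y * y * q ^ suc b * evenProd b y
  wrapSum (suc a) zero y = evenProd a y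
  wrapSum (suc a) (suc b) y = wrapSum a (suc b) (y * q) + y * y * q * wrapSum (suc a) b (y * q)

  wrapStart-+ : ∀ a → suc a ≤ M → (M ∸ suc a) ℕ.+ suc a ≡ M
  wrapStart-+ a le = NP.m∸n+n≡m le

  wrapStart-end : ∀ a c → suc a ≤ M → c < M → add (M ∸ suc a) (suc (a ℕ.+ c)) ≡ c
  wrapStart-end a c le c<M = trans (cong (_% M) (trans (eq (M ∸ suc a) a c) (cong (ℕ._+ c) (wrapStart-+ a le)))) (%-wrap c c<M)
    where eq : ∀ r a c → r ℕ.+ suc (a ℕ.+ c) ≡ r ℕ.+ suc a ℕ.+ c
          eq = NS.solve-∀

  wrapStart-step : ∀ a' → suc (suc a') ≤ M → add (M ∸ suc (suc a')) 1 ≡ M ∸ suc a'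
  wrapStart-step a' le = trans (add-small {r} {1} lt) (trans (NP.+-comm r 1) (sym e2))
    where
      r : ℕ
      r = M ∸ suc (suc a')
      h : r ℕ.+ suc (suc a') ≡ M
      h = wrapStart-+ (suc a') le
      lt : r ℕ.+ 1 < M
      lt = NP.≤-trans (NP.≤-reflexive (eq r)) (NP.≤-trans (NP.+-monoʳ-≤ r (s≤s (s≤s (z≤n {a'})))) (NP.≤-reflexive h))
        where eq : ∀ r → suc (r ℕ.+ 1) ≡ r ℕ.+ 2
              eq = NS.solve-∀
      e2 : M ∸ suc a' ≡ suc r
      e2 = trans (cong (ℕ._∸ suc a') (sym h)) (trans (cong (ℕ._∸ suc a') (NP.+-suc r (suc a'))) (NP.m+n∸n≡m (suc r) (suc a')))

  n≤wrapStart : ∀ a → suc a ≤ n → n ≤ M ∸ suc a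
  n≤wrapStart a le = NP.m+n≤o⇒m≤o∸n n (NP.+-monoʳ-≤ n le)

  wrapStart-flat : ∀ a j → suc a ≤ M → j ≤ a → (M ∸ suc a) ℕ.+ j < M
  wrapStart-flat a j le j≤a = NP.≤-trans (s≤s (NP.+-monoʳ-≤ (M ∸ suc a) j≤a)) (NP.≤-trans (NP.≤-reflexive (sym (NP.+-suc (M ∸ suc a) a))) (NP.≤-reflexive (wrapStart-+ a le)))

  module Wrapping where
    firstPart≤n : ∀ a b → suc (suc (a ℕ.+ b)) ≤ n → suc a ≤ n
    firstPart≤n a b kn = NP.≤-trans (NP.≤-trans (s≤s (NP.m≤m+n a b)) (NP.n≤1+n _)) kn
    secondPart≤n : ∀ a b → suc (suc (a ℕ.+ b)) ≤ n → suc b ≤ n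
    secondPart≤n a b kn = NP.≤-trans (NP.≤-trans (s≤s (NP.m≤n+m b a)) (NP.n≤1+n _)) kn
    n≤M : n ≤ M
    n≤M = NP.m≤m+n n n
    n≤M' : n ≤ M'
    n≤M' = NP.m≤n+m n n'

    sumLeft-wrap : ∀ a b → suc (suc (a ℕ.+ b)) ≤ n → ∀ x → sumLeft (M ∸ suc a) (a ℕ.+ b) x ≡ wrapSum a (suc b) (x * q)
    sumRight-wrap : ∀ a b → suc (suc (a ℕ.+ b)) ≤ n → ∀ x → sumRight (M ∸ suc a) (a ℕ.+ b) x ≡ q * wrapSum (suc a) b (x * q)

    -- starting at the last position M-1 (the value n): every later letter is
    -- smaller, and the rest is a flat window of negative values starting at 0
    sumLeft-wrap zero b kn x = begin
        sumLeft M' b x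
      ≡⟨ cong (λ t → sumOver (choices b) (λ ch → weight x (valAt M' ∷ decode t ch))) M'⊕1 ⟩
        sumOver (choices b) (λ ch → weight x (valAt M' ∷ decode 0 ch))
      ≡⟨ sum-prepend b x M' 0 (λ ch → ch) true descent ⟩
        x * x * (q * q) * q ^ bit (M' <ᵇ n) * sumAll 0 b (x * q)
      ≡⟨ cong (λ u → x * x * (q * q) * q ^ bit u * sumAll 0 b (x * q)) (<ᵇ-false {M'} {n} n≤M') ⟩
        x * x * (q * q) * + 1 * sumAll 0 b (x * q)
      ≡⟨ cong (λ u → x * x * (q * q) * + 1 * u) (sumAll-flat b 0 (x * q) (NP.≤-trans (secondPart≤n 0 b kn) n≤M)) ⟩
        x * x * (q * q) * + 1 * (q ^ negatives 0 (suc b) * evenProd b (x * q))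
      ≡⟨ cong (λ u → x * x * (q * q) * + 1 * (q ^ u * evenProd b (x * q))) (negatives-all (suc b) 0 (secondPart≤n 0 b kn)) ⟩
        x * x * (q * q) * + 1 * (q ^ suc b * evenProd b (x * q))
      ≡⟨ lem x q (q ^ suc b) (evenProd b (x * q)) ⟩
        x * q * (x * q) * q ^ suc b * evenProd b (x * q) ∎
      where
        open ≡-Reasoning
        lem : ∀ (x q Q F : ℤ) → x * x * (q * q) * + 1 * (Q * F) ≡ x * q * (x * q) * Q * F
        lem = solve-∀
        M'⊕1 : add M' 1 ≡ 0
        M'⊕1 = trans (cong (_% M) (NP.+-comm M' 1)) (n%n≡0 M)
        descent : ∀ ch → length ch ≡ b → (headPos 0 ch <ᵇ M') ≡ true
        descent ch l = <ᵇ-true (subst (ℕ._< M') (sym (headPos-flat 0 ch (NP.≤-trans length<M' (NP.n≤1+n M'))))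
                                      (NP.≤-<-trans (headOffset-≤ ch) length<M'))
          where
            length<M' : length ch < M'
            length<M' = NP.≤-trans (s≤s (NP.≤-reflexive l)) (NP.≤-trans (secondPart≤n 0 b kn) n≤M')
    -- a positive left end above the next window start: no descent after it on
    -- the left, a descent before the wrapped right end
    sumLeft-wrap (suc a') b kn x = begin
        sumLeft s (suc k') x
      ≡⟨ sumOver-cong (choices (suc k')) (λ ch → cong (λ t → weight x (valAt s ∷ decode t ch)) (wrapStart-step a' sa≤M)) ⟩
        sumOver (choices (suc k')) (λ ch → weight x (valAt s ∷ decode s1 ch))
      ≡⟨ prepend-split k' x s s1 false true (λ ch l → <ᵇ-false {s1} {s} s≤s1) wrappedDescent ⟩
        + 1 * q ^ bit (s <ᵇ n) * sumLeft s1 k' (x * q) + x * x * (q * q) * q ^ bit (s <ᵇ n) * sumRight s1 k' (x * q)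
      ≡⟨ cong (λ u → + 1 * q ^ bit u * sumLeft s1 k' (x * q) + x * x * (q * q) * q ^ bit u * sumRight s1 k' (x * q)) (<ᵇ-false {s} {n} n≤s) ⟩
        + 1 * + 1 * sumLeft s1 k' (x * q) + x * x * (q * q) * + 1 * sumRight s1 k' (x * q)
      ≡⟨ cong₂ (λ u v → + 1 * + 1 * u + x * x * (q * q) * + 1 * v) (sumLeft-wrap a' b kn' (x * q)) (sumRight-wrap a' b kn' (x * q)) ⟩
        + 1 * + 1 * wrapSum a' (suc b) (x * q * q) + x * x * (q * q) * + 1 * (q * wrapSum (suc a') b (x * q * q))
      ≡⟨ lem x q (wrapSum a' (suc b) (x * q * q)) (wrapSum (suc a') b (x * q * q)) ⟩
        wrapSum (suc a') (suc b) (x * q) ∎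
      where
        open ≡-Reasoning
        k' : ℕ
        k' = a' ℕ.+ b
        s : ℕ
        s = M ∸ suc (suc a')
        s1 : ℕ
        s1 = M ∸ suc a'
        kn' : suc (suc (a' ℕ.+ b)) ≤ n
        kn' = NP.≤-trans (NP.n≤1+n _) kn
        sa≤n = firstPart≤n (suc a') b kn
        sa≤M : suc (suc a') ≤ M
        sa≤M = NP.≤-trans sa≤n n≤M
        n≤s : n ≤ s
        n≤s = n≤wrapStart (suc a') sa≤n
        s≤s1 : s ≤ s1
        s≤s1 = NP.∸-monoʳ-≤ M (NP.n≤1+n (suc a'))
        wrappedDescent : ∀ ch → length ch ≡ k' → (headPos s1 (true ∷ ch) <ᵇ s) ≡ true
        wrappedDescent ch l = <ᵇ-true (subst (ℕ._< s)
          (sym (trans (cong (λ j → add s1 (suc j)) l) (wrapStart-end a' b (NP.≤-trans (NP.n≤1+n (suc a')) sa≤M) (NP.≤-trans (secondPart≤n (suc a') b kn) n≤M))))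
          (NP.≤-trans (secondPart≤n (suc a') b kn) n≤s))
        lem : ∀ (x q A B : ℤ) → + 1 * + 1 * A + x * x * (q * q) * + 1 * (q * B) ≡ A + x * q * (x * q) * q * B
        lem = solve-∀
    -- the right end 0 (the value -1) is below everything: no descent, one negative
    sumRight-wrap a zero kn x = begin
        sumRight s (a ℕ.+ 0) x
      ≡⟨ sumRight-const s (a ℕ.+ 0) x 0 false (wrapStart-end a 0 sa≤M (s≤s z≤n)) (λ ch l → refl) ⟩
        + 1 * q ^ 1 * sumAll s (a ℕ.+ 0) (x * q)
      ≡⟨ cong (λ u → + 1 * q ^ 1 * u) (sumAll-flat (a ℕ.+ 0) s (x * q) (wrapStart-flat a (a ℕ.+ 0) sa≤M (NP.≤-reflexive (NP.+-identityʳ a)))) ⟩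
        + 1 * q ^ 1 * (q ^ negatives s (suc (a ℕ.+ 0)) * evenProd (a ℕ.+ 0) (x * q))
      ≡⟨ cong₂ (λ u v → + 1 * q ^ 1 * (q ^ u * evenProd v (x * q))) (negatives-none (suc (a ℕ.+ 0)) s n≤s) (NP.+-identityʳ a) ⟩
        + 1 * q ^ 1 * (+ 1 * evenProd a (x * q))
      ≡⟨ lem q (evenProd a (x * q)) ⟩
        q * evenProd a (x * q) ∎
      where
        open ≡-Reasoning
        s : ℕ
        s = M ∸ suc a
        sa≤n = firstPart≤n a 0 kn
        sa≤M : suc a ≤ M
        sa≤M = NP.≤-trans sa≤n n≤M
        n≤s : n ≤ s
        n≤s = n≤wrapStart a sa≤n
        lem : ∀ (q F : ℤ) → + 1 * (q * + 1) * (+ 1 * F) ≡ q * F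
        lem = solve-∀
    -- a negative right end b'+1: above the left end of the rest, below its right end
    sumRight-wrap a (suc b') kn x = begin
        sumRight s (a ℕ.+ suc b') x
      ≡⟨ cong (λ k → sumRight s k x) (NP.+-suc a b') ⟩
        sumRight s (suc k') x
      ≡⟨ sumOver-choices-cong (suc k') (λ ch l → cong (λ p → weight x (valAt p ∷ decode s ch)) (rightEnd ch l)) ⟩
        sumOver (choices (suc k')) (λ ch → weight x (valAt (suc b') ∷ decode s ch))
      ≡⟨ prepend-split k' x (suc b') s false true (λ ch l → <ᵇ-false {s} {suc b'} (NP.≤-trans (NP.<⇒≤ sb<n) n≤s)) descent ⟩
        + 1 * q ^ bit (suc b' <ᵇ n) * sumLeft s k' (x * q) + x * x * (q * q) * q ^ bit (suc b' <ᵇ n) * sumRight s k' (x * q)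
      ≡⟨ cong (λ u → + 1 * q ^ bit u * sumLeft s k' (x * q) + x * x * (q * q) * q ^ bit u * sumRight s k' (x * q)) (<ᵇ-true {suc b'} {n} sb<n) ⟩
        + 1 * q ^ 1 * sumLeft s k' (x * q) + x * x * (q * q) * q ^ 1 * sumRight s k' (x * q)
      ≡⟨ cong₂ (λ u v → + 1 * q ^ 1 * u + x * x * (q * q) * q ^ 1 * v) (sumLeft-wrap a b' kn' (x * q)) (sumRight-wrap a b' kn' (x * q)) ⟩
        + 1 * q ^ 1 * wrapSum a (suc b') (x * q * q) + x * x * (q * q) * q ^ 1 * (q * wrapSum (suc a) b' (x * q * q))
      ≡⟨ lem x q (wrapSum a (suc b') (x * q * q)) (wrapSum (suc a) b' (x * q * q)) ⟩
        q * wrapSum (suc a) (suc b') (x * q) ∎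
      where
        open ≡-Reasoning
        k' : ℕ
        k' = a ℕ.+ b'
        s : ℕ
        s = M ∸ suc a
        kn' : suc (suc (a ℕ.+ b')) ≤ n
        kn' = NP.≤-trans (s≤s (s≤s (NP.+-monoʳ-≤ a (NP.n≤1+n b')))) kn
        sa≤n = firstPart≤n a (suc b') kn
        sa≤M : suc a ≤ M
        sa≤M = NP.≤-trans sa≤n n≤M
        n≤s : n ≤ s
        n≤s = n≤wrapStart a sa≤n
        sb<n : suc b' < n
        sb<n = secondPart≤n a (suc b') kn
        rightEnd : ∀ ch → length ch ≡ suc k' → add s (suc (length ch)) ≡ suc b'
        rightEnd ch l = trans (cong (λ j → add s (suc j)) (trans l (sym (NP.+-suc a b'))))
                          (wrapStart-end a (suc b') sa≤M (NP.≤-trans sb<n n≤M))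
        descent : ∀ ch → length ch ≡ k' → (headPos s (true ∷ ch) <ᵇ suc b') ≡ true
        descent ch l = <ᵇ-true (subst (ℕ._< suc b') (sym (trans (cong (λ j → add s (suc j)) l)
          (wrapStart-end a b' sa≤M (NP.≤-trans (NP.≤-trans (NP.n≤1+n (suc b')) sb<n) n≤M)))) NP.≤-refl)
        lem : ∀ (x q A B : ℤ) → + 1 * (q * + 1) * A + x * x * (q * q) * (q * + 1) * (q * B) ≡ q * (A + x * q * (x * q) * q * B)
        lem = solve-∀

module Expansion (m : ℕ) (t q : ℤ) where

  open import Defs
  open Sums
  open Reflection
  open CyclicArithmetic
  open Encoding
  open Enumeration
  open Statistics
  open import Data.Nat as ℕ using (ℕ; _≤_; _<_; zero; suc; _∸_; z≤n; s≤s; _<ᵇ_)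
  open import Data.Integer using (ℤ; +_; _+_; _*_; _-_; _^_)
  open import Data.Bool using (true; false)
  open import Data.List using (List; _∷_; length)
  open import Relation.Binary.PropositionalEquality using (_≡_; refl; sym; trans; cong; cong₂; module ≡-Reasoning)
  import Data.Nat.Properties as NP
  import Data.Integer.Properties as ZP
  open import Data.Integer.Properties using (^-distribˡ-+-*)
  import Data.Nat.Tactic.RingSolver as NS
  open import Data.Integer.Tactic.RingSolver using (solve-∀)

  n' : ℕ
  n' = suc m
  open Circle n'
  open Count n'
  open Windows n' q

  summand : List ℤ → ℤ
  summand w = t ^ fdes n w * q ^ fmaj n w

  summand-weight : ∀ p rest → summand (valAt p ∷ rest) ≡ t ^ bit (p <ᵇ n) * weight t (valAt p ∷ rest)
  summand-weight p rest =
    trans (cong (_* q ^ fmaj n (valAt p ∷ rest)) (trans (cong (λ b → t ^ (2 ℕ.* des n (valAt p ∷ rest) ℕ.+ bit b)) (isNeg-valAt p)) (^-distribˡ-+-* t (2 ℕ.* des n (valAt p ∷ rest)) (bit (p <ᵇ n)))))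
          (lem (t ^ (2 ℕ.* des n (valAt p ∷ rest))) (t ^ bit (p <ᵇ n)) (q ^ fmaj n (valAt p ∷ rest)))
    where lem : ∀ (a b c : ℤ) → a * b * c ≡ b * (a * c)
          lem = solve-∀

  genFun-decode : genFun n t q ≡ sumBelow M (λ s → sumOver (choices (suc m)) (λ ch → summand (decode s ch)))
  genFun-decode = trans (sumOver-filter (isBArc n) (Bn n) summand) (trans (sumOver-filter isSignedPerm (words V n) _)
    (trans (sumOver-cong (words V n) (λ w → sym (when-∧ (isSignedPerm w) (isBArc n w) (summand w))))
    (sum-arcWords (suc m) NP.≤-refl summand)))

  -- the contribution of all B-arc permutations whose last letter sits at s
  startSum : ℕ → ℤ
  startSum s = t ^ bit (s <ᵇ n) * sumLeft s m t + t ^ bit (add s (suc m) <ᵇ n) * sumRight s m t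

  startSum-choices : ∀ s → sumOver (choices (suc m)) (λ ch → summand (decode s ch)) ≡ startSum s
  startSum-choices s = trans (sumOver-choices m (λ ch → summand (decode s ch))) (cong₂ _+_
    (trans (sumOver-cong (choices m) (λ ch → summand-weight s (decode (add s 1) ch)))
           (sym (sumOver-*ˡ (t ^ bit (s <ᵇ n)) (choices m) (λ ch → weight t (decode s (false ∷ ch))))))
    (trans (sumOver-choices-cong m (λ ch l → trans (summand-weight (add s (suc (length ch))) (decode s ch))
                  (cong (λ j → t ^ bit (add s (suc j) <ᵇ n) * weight t (decode s (true ∷ ch))) l)))
           (sym (sumOver-*ˡ (t ^ bit (add s (suc m) <ᵇ n)) (choices m) (λ ch → weight t (decode s (true ∷ ch)))))))

  M-split : M ≡ suc n ℕ.+ suc m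
  M-split = eq m
    where eq : ∀ m → suc (suc m) ℕ.+ suc (suc m) ≡ suc (suc (suc m)) ℕ.+ suc m
          eq = NS.solve-∀

  -- starts 0,…,n give windows that do not wrap, starts n+1,…,2n-1 wrapping ones
  genFun-starts : genFun n t q ≡ sumBelow (suc n) startSum + sumBelow (suc m) (λ i → startSum (suc n ℕ.+ i))
  genFun-starts = trans genFun-decode (trans (sumBelow-cong M (λ s _ → startSum-choices s)) (trans (cong (λ k → sumBelow k startSum) M-split) (sumBelow-split (suc n) (suc m) startSum)))

  Em : ℤ
  Em = evenProd m (t * q)

  startSum-flat : ∀ s → s ≤ n → startSum s ≡
    t ^ bit (s <ᵇ n) * (+ 1 * q ^ bit (s <ᵇ n) * (q ^ negatives (suc s) (suc m) * Em))
    + t ^ bit (s ℕ.+ suc m <ᵇ n) * (t * t * (q * q) * q ^ bit (s ℕ.+ suc m <ᵇ n) * (q ^ negatives s (suc m) * Em))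
  startSum-flat s s≤n = cong₂ _+_
      (cong (t ^ bit (s <ᵇ n) *_) (trans (sumLeft-flat s m t lt) (cong (+ 1 * q ^ bit (s <ᵇ n) *_) (sumAll-flat m (suc s) (t * q) lt'))))
      (trans (cong (λ p → t ^ bit (p <ᵇ n) * sumRight s m t) (add-small {s} {suc m} lt))
        (cong (t ^ bit (s ℕ.+ suc m <ᵇ n) *_) (trans (sumRight-flat s m t lt) (cong (t * t * (q * q) * q ^ bit (s ℕ.+ suc m <ᵇ n) *_) (sumAll-flat m s (t * q) lt'')))))
    where
      lt : s ℕ.+ suc m < M
      lt = NP.≤-trans (s≤s (NP.+-monoˡ-≤ (suc m) s≤n)) (NP.≤-reflexive (sym (NP.+-suc n (suc m))))
      lt' : suc s ℕ.+ m < M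
      lt' = NP.≤-trans (NP.≤-reflexive (cong suc (sym (NP.+-suc s m)))) lt
      lt'' : s ℕ.+ m < M
      lt'' = NP.≤-<-trans (NP.+-monoʳ-≤ s (NP.n≤1+n m)) lt

  -- start 0: all n letters negative
  startSum-0 : startSum 0 ≡ (t * q + t * (t * t * (q * q)) * q) * q ^ suc m * Em
  startSum-0 = trans (startSum-flat 0 z≤n) (trans (cong₂ (λ u v → t ^ 1 * (+ 1 * q ^ 1 * (q ^ u * Em)) + t ^ bit v * (t * t * (q * q) * q ^ bit v * (q ^ negatives 0 (suc m) * Em)))
          (negatives-all (suc m) 1 NP.≤-refl) (<ᵇ-true {suc m} {n} NP.≤-refl))
          (trans (cong (λ u → t ^ 1 * (+ 1 * q ^ 1 * (q ^ suc m * Em)) + t ^ 1 * (t * t * (q * q) * q ^ 1 * (q ^ u * Em))) (negatives-all (suc m) 0 (NP.n≤1+n (suc m))))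
          (lem t q (q ^ suc m) Em)))
    where lem : ∀ (t q Z F : ℤ) → t * + 1 * (+ 1 * (q * + 1) * (Z * F)) + t * + 1 * (t * t * (q * q) * (q * + 1) * (Z * F)) ≡ (t * q + t * (t * t * (q * q)) * q) * Z * F
          lem = solve-∀

  startSum-mid : ∀ j → j ≤ m → startSum (suc j) ≡ (t * q + t * t * (q * q) * q) * Em * q ^ (m ∸ j)
  startSum-mid j j≤m = trans (startSum-flat (suc j) (NP.≤-trans (s≤s j≤m) (NP.n≤1+n (suc m))))
     (trans (cong (λ w → t ^ bit w * (+ 1 * q ^ bit w * (q ^ negatives (suc (suc j)) (suc m) * Em)) + t ^ bit (suc j ℕ.+ suc m <ᵇ n) * (t * t * (q * q) * q ^ bit (suc j ℕ.+ suc m <ᵇ n) * (q ^ negatives (suc j) (suc m) * Em)))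
        (<ᵇ-true {suc j} {n} (s≤s (s≤s j≤m))))
     (trans (cong₂ (λ u v → t ^ 1 * (+ 1 * q ^ 1 * (q ^ u * Em)) + t ^ bit v * (t * t * (q * q) * q ^ bit v * (q ^ negatives (suc j) (suc m) * Em)))
          (negatives-partial (suc m) (suc (suc j)) (s≤s (s≤s j≤m)) (NP.≤-trans (NP.m∸n≤m m j) (NP.n≤1+n m)))
          (<ᵇ-false {suc j ℕ.+ suc m} {n} (s≤s (NP.m≤n+m (suc m) j))))
     (trans (cong (λ u → t ^ 1 * (+ 1 * q ^ 1 * (q ^ (m ∸ j) * Em)) + t ^ 0 * (t * t * (q * q) * q ^ 0 * (q ^ u * Em)))
          (trans (negatives-partial (suc m) (suc j) (NP.≤-trans (s≤s j≤m) (NP.n≤1+n (suc m))) (NP.m∸n≤m (suc m) j)) (NP.+-∸-assoc 1 j≤m)))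
     (lem t q (q ^ (m ∸ j)) Em))))
    where lem : ∀ (t q Q F : ℤ) → t * + 1 * (+ 1 * (q * + 1) * (Q * F)) + + 1 * (t * t * (q * q) * + 1 * (q * Q * F)) ≡ (t * q + t * t * (q * q) * q) * F * Q
          lem = solve-∀

  -- start n: all letters positive
  startSum-n : startSum n ≡ (+ 1 + t * t * (q * q)) * Em
  startSum-n = trans (startSum-flat n NP.≤-refl)
    (trans (cong₂ (λ u v → t ^ bit u * (+ 1 * q ^ bit u * (q ^ negatives (suc n) (suc m) * Em)) + t ^ bit v * (t * t * (q * q) * q ^ bit v * (q ^ negatives n (suc m) * Em)))
        (<ᵇ-false {n} {n} NP.≤-refl) (<ᵇ-false {n ℕ.+ suc m} {n} (NP.m≤m+n n (suc m))))
    (trans (cong₂ (λ u v → + 1 * (+ 1 * + 1 * (q ^ u * Em)) + + 1 * (t * t * (q * q) * + 1 * (q ^ v * Em)))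
        (negatives-none (suc m) (suc n) (NP.n≤1+n n)) (negatives-none (suc m) n NP.≤-refl))
    (lem t q Em)))
    where lem : ∀ (t q F : ℤ) → + 1 * (+ 1 * + 1 * (+ 1 * F)) + + 1 * (t * t * (q * q) * + 1 * (+ 1 * F)) ≡ (+ 1 + t * t * (q * q)) * F
          lem = solve-∀

  open Wrapping

  startSum-wrap : ∀ i → i ≤ m → startSum (suc n ℕ.+ i) ≡ wrapSum (m ∸ i) (suc i) (t * q) + t * (q * wrapSum (suc (m ∸ i)) i (t * q))
  startSum-wrap i i≤m = begin
      startSum (suc n ℕ.+ i)
    ≡⟨ cong₂ (λ s k → t ^ bit (s <ᵇ n) * sumLeft s k t + t ^ bit (add s (suc k) <ᵇ n) * sumRight s k t) sEq mEq ⟩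
      t ^ bit (S <ᵇ n) * sumLeft S (a ℕ.+ i) t + t ^ bit (add S (suc (a ℕ.+ i)) <ᵇ n) * sumRight S (a ℕ.+ i) t
    ≡⟨ cong₂ (λ u v → t ^ bit (S <ᵇ n) * u + t ^ bit (add S (suc (a ℕ.+ i)) <ᵇ n) * v) (sumLeft-wrap a i kn t) (sumRight-wrap a i kn t) ⟩
      t ^ bit (S <ᵇ n) * wrapSum a (suc i) (t * q) + t ^ bit (add S (suc (a ℕ.+ i)) <ᵇ n) * (q * wrapSum (suc a) i (t * q))
    ≡⟨ cong₂ (λ u v → t ^ bit u * wrapSum a (suc i) (t * q) + t ^ bit (v <ᵇ n) * (q * wrapSum (suc a) i (t * q)))
         (<ᵇ-false {S} {n} (n≤wrapStart a sa≤n)) (wrapStart-end a i sa≤M (NP.≤-trans i<n n≤M)) ⟩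
      + 1 * wrapSum a (suc i) (t * q) + t ^ bit (i <ᵇ n) * (q * wrapSum (suc a) i (t * q))
    ≡⟨ cong (λ u → + 1 * wrapSum a (suc i) (t * q) + t ^ bit u * (q * wrapSum (suc a) i (t * q))) (<ᵇ-true {i} {n} i<n) ⟩
      + 1 * wrapSum a (suc i) (t * q) + t ^ 1 * (q * wrapSum (suc a) i (t * q))
    ≡⟨ lem t q (wrapSum a (suc i) (t * q)) (wrapSum (suc a) i (t * q)) ⟩
      wrapSum a (suc i) (t * q) + t * (q * wrapSum (suc a) i (t * q)) ∎
    where
      open ≡-Reasoning
      a : ℕ
      a = m ∸ i
      S : ℕ
      S = M ∸ suc a
      e1 : suc n ℕ.+ i ℕ.+ suc a ≡ M
      e1 = trans (eq (suc n) i a) (trans (cong (λ x → suc n ℕ.+ suc x) (NP.m+[n∸m]≡n i≤m)) (sym M-split))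
        where eq : ∀ N i d → N ℕ.+ i ℕ.+ suc d ≡ N ℕ.+ suc (i ℕ.+ d)
              eq = NS.solve-∀
      sEq : suc n ℕ.+ i ≡ S
      sEq = sym (trans (cong (ℕ._∸ suc a) (sym e1)) (NP.m+n∸n≡m (suc n ℕ.+ i) (suc a)))
      mEq : m ≡ a ℕ.+ i
      mEq = sym (NP.m∸n+n≡m i≤m)
      kn : suc (suc (a ℕ.+ i)) ≤ n
      kn = NP.≤-reflexive (cong (λ x → suc (suc x)) (sym mEq))
      sa≤n : suc a ≤ n
      sa≤n = firstPart≤n a i kn
      sa≤M : suc a ≤ M
      sa≤M = NP.≤-trans sa≤n n≤M
      i<n : i < n
      i<n = NP.≤-trans (s≤s i≤m) (NP.n≤1+n (suc m))
      lem : ∀ (t q A B : ℤ) → + 1 * A + t * + 1 * (q * B) ≡ A + t * (q * B)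
      lem = solve-∀

  wrapTotal wrapTotal′ : ℕ → ℤ → ℤ
  wrapTotal k y = sumBelow (suc k) (λ i → wrapSum (k ∸ i) (suc i) y)
  wrapTotal′ k y = sumBelow (suc k) (λ i → wrapSum (suc (k ∸ i)) i y)

  geomSum : ℕ → ℤ
  geomSum k = sumBelow (suc k) (λ j → q ^ (k ∸ j))

  midCoeff : ℤ
  midCoeff = t * q + t * t * (q * q) * q

  flat-starts : sumBelow (suc n) startSum ≡
    (t * q + t * (t * t * (q * q)) * q) * q ^ suc m * Em + midCoeff * Em * geomSum m + (+ 1 + t * t * (q * q)) * Em
  flat-starts = begin
      startSum 0 + sumBelow (suc (suc m)) (λ i → startSum (suc i))
    ≡⟨ cong (_+_ (startSum 0)) (sumBelow-snoc (suc m) (λ i → startSum (suc i))) ⟩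
      startSum 0 + (sumBelow (suc m) (λ i → startSum (suc i)) + startSum n)
    ≡⟨ sym (ZP.+-assoc (startSum 0) _ (startSum n)) ⟩
      startSum 0 + sumBelow (suc m) (λ i → startSum (suc i)) + startSum n
    ≡⟨ cong₂ (λ u v → u + v + startSum n) startSum-0
         (trans (sumBelow-cong (suc m) (λ j j< → startSum-mid j (NP.≤-pred j<))) (sym (sumBelow-*ˡ (midCoeff * Em) (suc m) (λ j → q ^ (m ∸ j))))) ⟩
      (t * q + t * (t * t * (q * q)) * q) * q ^ suc m * Em + midCoeff * Em * geomSum m + startSum n
    ≡⟨ cong (_+_ ((t * q + t * (t * t * (q * q)) * q) * q ^ suc m * Em + midCoeff * Em * geomSum m)) startSum-n ⟩
      (t * q + t * (t * t * (q * q)) * q) * q ^ suc m * Em + midCoeff * Em * geomSum m + (+ 1 + t * t * (q * q)) * Em ∎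
    where open ≡-Reasoning

  wrap-starts : sumBelow (suc m) (λ i → startSum (suc n ℕ.+ i)) ≡ wrapTotal m (t * q) + t * (q * wrapTotal′ m (t * q))
  wrap-starts = begin
      sumBelow (suc m) (λ i → startSum (suc n ℕ.+ i))
    ≡⟨ sumBelow-cong (suc m) (λ i i< → startSum-wrap i (NP.≤-pred i<)) ⟩
      sumBelow (suc m) (λ i → wrapSum (m ∸ i) (suc i) (t * q) + t * (q * wrapSum (suc (m ∸ i)) i (t * q)))
    ≡⟨ sumBelow-+ (suc m) (λ i → wrapSum (m ∸ i) (suc i) (t * q)) (λ i → t * (q * wrapSum (suc (m ∸ i)) i (t * q))) ⟩
      wrapTotal m (t * q) + sumBelow (suc m) (λ i → t * (q * wrapSum (suc (m ∸ i)) i (t * q)))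
    ≡⟨ cong (_+_ (wrapTotal m (t * q))) (sym (trans (cong (t *_) (sumBelow-*ˡ q (suc m) (λ i → wrapSum (suc (m ∸ i)) i (t * q))))
           (sumBelow-*ˡ t (suc m) (λ i → q * wrapSum (suc (m ∸ i)) i (t * q))))) ⟩
      wrapTotal m (t * q) + t * (q * wrapTotal′ m (t * q)) ∎
    where open ≡-Reasoning

  genFun-form : genFun n t q ≡
    (t * q + t * (t * t * (q * q)) * q) * q ^ suc m * Em + midCoeff * Em * geomSum m + (+ 1 + t * t * (q * q)) * Em
    + (wrapTotal m (t * q) + t * (q * wrapTotal′ m (t * q)))
  genFun-form = trans genFun-starts (cong₂ _+_ flat-starts wrap-starts)

  -- the two totals differ only in their extreme terms
  wrapTotal′-eq : ∀ k y → wrapTotal′ k y ≡ wrapTotal k y + (+ 1 - y * y * q ^ suc k) * evenProd k y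
  wrapTotal′-eq k y = begin
      evenProd k y + sumBelow k (λ i → wrapSum (suc (k ∸ suc i)) (suc i) y)
    ≡⟨ cong (_+_ (evenProd k y)) (sumBelow-cong k (λ i i<k → cong (λ a → wrapSum a (suc i) y) (sym (NP.+-∸-assoc 1 {k} {suc i} i<k)))) ⟩
      evenProd k y + X
    ≡⟨ sym (rearrange X A (evenProd k y)) ⟩
      X + A * evenProd k y + (+ 1 - A) * evenProd k y
    ≡⟨ cong (_+ (+ 1 - A) * evenProd k y) (sym lastTerm) ⟩
      wrapTotal k y + (+ 1 - A) * evenProd k y ∎
    where
      open ≡-Reasoning
      X : ℤ
      X = sumBelow k (λ i → wrapSum (k ∸ i) (suc i) y)
      A : ℤ
      A = y * y * q ^ suc k
      lastTerm : wrapTotal k y ≡ X + A * evenProd k y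
      lastTerm = trans (sumBelow-snoc k (λ i → wrapSum (k ∸ i) (suc i) y)) (cong (λ a → X + wrapSum a (suc k) y) (NP.n∸n≡0 k))
      rearrange : ∀ (X A F : ℤ) → X + A * F + (+ 1 - A) * F ≡ F + X
      rearrange = solve-∀

  genFun-expanded : genFun n t q ≡
    (t * q + t * (t * t * (q * q)) * q) * q ^ suc m * Em + midCoeff * Em * geomSum m + (+ 1 + t * t * (q * q)) * Em
    + (wrapTotal m (t * q) + t * (q * (wrapTotal m (t * q) + (+ 1 - t * q * (t * q) * q ^ suc m) * Em)))
  genFun-expanded = trans genFun-form (cong (λ u → (t * q + t * (t * t * (q * q)) * q) * q ^ suc m * Em + midCoeff * Em * geomSum m
    + (+ 1 + t * t * (q * q)) * Em + (wrapTotal m (t * q) + t * (q * u))) (wrapTotal′-eq m (t * q)))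

  wrapTotal-step : ∀ k y → wrapTotal (suc k) y ≡ wrapTotal k (y * q) + y * y * q * wrapTotal′ k (y * q) + y * y * q ^ suc (suc k) * evenProd (suc k) y
  wrapTotal-step k y = trans (sumBelow-snoc (suc k) (λ i → wrapSum (suc k ∸ i) (suc i) y))
    (trans (cong₂ _+_
       (trans (sumBelow-cong (suc k) (λ i i< → cong (λ a → wrapSum a (suc i) y) (NP.+-∸-assoc 1 {k} {i} (NP.≤-pred i<))))
         (trans (sumBelow-+ (suc k) (λ i → wrapSum (k ∸ i) (suc i) (y * q)) (λ i → y * y * q * wrapSum (suc (k ∸ i)) i (y * q)))
           (cong (_+_ (wrapTotal k (y * q))) (sym (sumBelow-*ˡ (y * y * q) (suc k) (λ i → wrapSum (suc (k ∸ i)) i (y * q)))))))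
       (cong (λ a → wrapSum a (suc (suc k)) y) (NP.n∸n≡0 k)))
     refl)

  -- oddProd k y = Π_{i=1}^{k} (1 + y² q^{2i-1})
  oddProd : ℕ → ℤ → ℤ
  oddProd zero y = + 1
  oddProd (suc k) y = (+ 1 + y * y * q) * oddProd k (y * q)

  wrapTotal-closed : ∀ k y → (+ 1 - q) * wrapTotal k y ≡ (+ 1 - y * y * (q ^ suc k * q ^ suc k)) * oddProd k y - (+ 1 - y * y * q ^ suc k) * evenProd k y
  wrapTotal-closed zero y = lem y q
    where lem : ∀ (y q : ℤ) → (+ 1 - q) * (y * y * (q * + 1) * + 1 + + 0) ≡ (+ 1 - y * y * (q * + 1 * (q * + 1))) * + 1 - (+ 1 - y * y * (q * + 1)) * + 1
          lem = solve-∀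
  wrapTotal-closed (suc k) y = begin
      (+ 1 - q) * wrapTotal (suc k) y
    ≡⟨ cong (_*_ (+ 1 - q)) (trans (wrapTotal-step k y) (cong (λ u → wrapTotal k (y * q) + y * y * q * u + y * y * q ^ suc (suc k) * evenProd (suc k) y) (wrapTotal′-eq k (y * q)))) ⟩
      (+ 1 - q) * (ρ + y * y * q * (ρ + (+ 1 - y * q * (y * q) * Z) * Ek) + y * y * (q * Z) * ((+ 1 + y * y * (q * q)) * Ek))
    ≡⟨ separate y q Z ρ Ek ⟩
      (+ 1 + y * y * q) * ((+ 1 - q) * ρ) + (+ 1 - q) * (y * y * q * (+ 1 - y * q * (y * q) * Z) * Ek + y * y * (q * Z) * ((+ 1 + y * y * (q * q)) * Ek))
    ≡⟨ cong (λ u → (+ 1 + y * y * q) * u + (+ 1 - q) * (y * y * q * (+ 1 - y * q * (y * q) * Z) * Ek + y * y * (q * Z) * ((+ 1 + y * y * (q * q)) * Ek))) (wrapTotal-closed k (y * q)) ⟩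
      (+ 1 + y * y * q) * ((+ 1 - y * q * (y * q) * (Z * Z)) * Ok - (+ 1 - y * q * (y * q) * Z) * Ek) + (+ 1 - q) * (y * y * q * (+ 1 - y * q * (y * q) * Z) * Ek + y * y * (q * Z) * ((+ 1 + y * y * (q * q)) * Ek))
    ≡⟨ simplify y q Z Ok Ek ⟩
      (+ 1 - y * y * (q * Z * (q * Z))) * ((+ 1 + y * y * q) * Ok) - (+ 1 - y * y * (q * Z)) * ((+ 1 + y * y * (q * q)) * Ek) ∎
    where
      open ≡-Reasoning
      ρ : ℤ
      ρ = wrapTotal k (y * q)
      Z : ℤ
      Z = q ^ suc k
      Ek : ℤ
      Ek = evenProd k (y * q)
      Ok : ℤ
      Ok = oddProd k (y * q)
      separate : ∀ (y q Z ρ F : ℤ) → (+ 1 - q) * (ρ + y * y * q * (ρ + (+ 1 - y * q * (y * q) * Z) * F) + y * y * (q * Z) * ((+ 1 + y * y * (q * q)) * F))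
             ≡ (+ 1 + y * y * q) * ((+ 1 - q) * ρ) + (+ 1 - q) * (y * y * q * (+ 1 - y * q * (y * q) * Z) * F + y * y * (q * Z) * ((+ 1 + y * y * (q * q)) * F))
      separate = solve-∀
      simplify : ∀ (y q Z Ok F : ℤ) → (+ 1 + y * y * q) * ((+ 1 - y * q * (y * q) * (Z * Z)) * Ok - (+ 1 - y * q * (y * q) * Z) * F) + (+ 1 - q) * (y * y * q * (+ 1 - y * q * (y * q) * Z) * F + y * y * (q * Z) * ((+ 1 + y * y * (q * q)) * F))
             ≡ (+ 1 - y * y * (q * Z * (q * Z))) * ((+ 1 + y * y * q) * Ok) - (+ 1 - y * y * (q * Z)) * ((+ 1 + y * y * (q * q)) * F)
      simplify = solve-∀

  geomSum-closed : ∀ k → (+ 1 - q) * geomSum k ≡ + 1 - q ^ suc k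
  geomSum-closed zero = lem q
    where lem : ∀ (q : ℤ) → (+ 1 - q) * (+ 1 + + 0) ≡ + 1 - q * + 1
          lem = solve-∀
  geomSum-closed (suc k) = trans (separate q (q ^ suc k) (geomSum k)) (trans (cong (λ u → q ^ suc k - q * q ^ suc k + u) (geomSum-closed k)) (simplify q (q ^ suc k)))
    where separate : ∀ (q Z g : ℤ) → (+ 1 - q) * (Z + g) ≡ Z - q * Z + (+ 1 - q) * g
          separate = solve-∀
          simplify : ∀ (q Z : ℤ) → Z - q * Z + (+ 1 - Z) ≡ + 1 - q * Z
          simplify = solve-∀

  prodFrom1-front : ∀ k f → prodFrom1 (suc k) f ≡ f 1 * prodFrom1 k (λ i → f (suc i))
  prodFrom1-front zero f = ZP.*-comm (+ 1) (f 1)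
  prodFrom1-front (suc k) f = trans (cong (_* f (suc (suc k))) (prodFrom1-front k f)) (ZP.*-assoc (f 1) _ (f (suc (suc k))))

  prodFrom1-cong : ∀ k {f g : ℕ → ℤ} → (∀ i → f i ≡ g i) → prodFrom1 k f ≡ prodFrom1 k g
  prodFrom1-cong zero e = refl
  prodFrom1-cong (suc k) e = cong₂ _*_ (prodFrom1-cong k e) (e (suc k))

  prodFrom1-scaled : ∀ c (P : ℕ → ℤ → ℤ) → (∀ y → P 0 y ≡ + 1) →
    (∀ k y → P (suc k) y ≡ (+ 1 + y * y * q ^ c) * P k (y * q)) →
    ∀ k x → prodFrom1 k (λ i → + 1 + x ^ 2 * q ^ (2 ℕ.* i ℕ.+ c)) ≡ P k (x * q)
  prodFrom1-scaled c P P-zero P-suc zero x = sym (P-zero (x * q))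
  prodFrom1-scaled c P P-zero P-suc (suc k) x =
    trans (prodFrom1-front k _)
    (trans (cong₂ _*_ (firstFactor x q (q ^ c))
                      (trans (prodFrom1-cong k (λ i → cong (_+_ (+ 1)) (shift i))) (prodFrom1-scaled c P P-zero P-suc k (x * q))))
           (sym (P-suc k (x * q))))
    where
      firstFactor : ∀ (x q Q : ℤ) → + 1 + x * (x * + 1) * (q * (q * Q)) ≡ + 1 + x * q * (x * q) * Q
      firstFactor = solve-∀
      shift : ∀ i → x ^ 2 * q ^ (2 ℕ.* suc i ℕ.+ c) ≡ (x * q) ^ 2 * q ^ (2 ℕ.* i ℕ.+ c)
      shift i = trans (cong (λ e → x ^ 2 * q ^ e) (exponent i c)) (lem x q (q ^ (2 ℕ.* i ℕ.+ c)))
        where exponent : ∀ i c → 2 ℕ.* suc i ℕ.+ c ≡ 2 ℕ.+ (2 ℕ.* i ℕ.+ c)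
              exponent = NS.solve-∀
              lem : ∀ (x q Q : ℤ) → x * (x * + 1) * (q * (q * Q)) ≡ x * q * (x * q * + 1) * Q
              lem = solve-∀

  oddProd-prodFrom1 : ∀ k x → prodFrom1 k (λ i → + 1 + x ^ 2 * q ^ (2 ℕ.* i ℕ.+ 1)) ≡ oddProd k (x * q)
  oddProd-prodFrom1 = prodFrom1-scaled 1 oddProd (λ _ → refl)
    (λ k y → cong (λ z → (+ 1 + y * y * z) * oddProd k (y * q)) (sym (ZP.*-identityʳ q)))

  evenProd-prodFrom1 : ∀ k x → prodFrom1 k (λ i → + 1 + x ^ 2 * q ^ (2 ℕ.* i ℕ.+ 2)) ≡ evenProd k (x * q)
  evenProd-prodFrom1 = prodFrom1-scaled 2 evenProd (λ _ → refl)
    (λ k y → cong (λ z → (+ 1 + y * y * (q * z)) * evenProd k (y * q)) (sym (ZP.*-identityʳ q)))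

  qIdentity : (+ 1 - q) * genFun n t q
        ≡ (+ 1 + t * q) * (+ 1 + t * q ^ n)
          * ((+ 1 - t * q ^ n) * prodFrom1 m (λ i → + 1 + t ^ 2 * q ^ (2 ℕ.* i ℕ.+ 1))
             - (+ 1 - t) * q * prodFrom1 m (λ i → + 1 + t ^ 2 * q ^ (2 ℕ.* i ℕ.+ 2)))
  qIdentity = begin
      (+ 1 - q) * genFun n t q
    ≡⟨ cong (_*_ (+ 1 - q)) genFun-expanded ⟩
      (+ 1 - q) * (A0 + midCoeff * Em * geomSum m + B0 + (ρ + t * (q * (ρ + (+ 1 - t * q * (t * q) * q ^ suc m) * Em))))
    ≡⟨ separate t q (q ^ suc m) Em (geomSum m) ρ A0 B0 midCoeff ⟩
      midCoeff * Em * ((+ 1 - q) * geomSum m) + (+ 1 + t * q) * ((+ 1 - q) * ρ) + (+ 1 - q) * (A0 + B0 + t * q * ((+ 1 - t * q * (t * q) * q ^ suc m) * Em))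
    ≡⟨ cong₂ (λ u v → midCoeff * Em * u + (+ 1 + t * q) * v + (+ 1 - q) * (A0 + B0 + t * q * ((+ 1 - t * q * (t * q) * q ^ suc m) * Em)))
         (geomSum-closed m) (wrapTotal-closed m (t * q)) ⟩
      midCoeff * Em * (+ 1 - q * W) + (+ 1 + t * q) * ((+ 1 - t * q * (t * q) * (q * W * (q * W))) * Om - (+ 1 - t * q * (t * q) * (q * W)) * Em)
        + (+ 1 - q) * (A0 + B0 + t * q * ((+ 1 - t * q * (t * q) * (q * W)) * Em))
    ≡⟨ simplify t q W Em Om ⟩
      (+ 1 + t * q) * (+ 1 + t * (q * (q * W))) * ((+ 1 - t * (q * (q * W))) * Om - (+ 1 - t) * q * Em)
    ≡⟨ cong₂ (λ u v → (+ 1 + t * q) * (+ 1 + t * (q * (q * W))) * ((+ 1 - t * (q * (q * W))) * u - (+ 1 - t) * q * v))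
         (sym (oddProd-prodFrom1 m t)) (sym (evenProd-prodFrom1 m t)) ⟩
      (+ 1 + t * q) * (+ 1 + t * q ^ n)
          * ((+ 1 - t * q ^ n) * prodFrom1 m (λ i → + 1 + t ^ 2 * q ^ (2 ℕ.* i ℕ.+ 1))
             - (+ 1 - t) * q * prodFrom1 m (λ i → + 1 + t ^ 2 * q ^ (2 ℕ.* i ℕ.+ 2))) ∎
    where
      open ≡-Reasoning
      W : ℤ
      W = q ^ m
      ρ : ℤ
      ρ = wrapTotal m (t * q)
      Om : ℤ
      Om = oddProd m (t * q)
      A0 : ℤ
      A0 = (t * q + t * (t * t * (q * q)) * q) * q ^ suc m * Em
      B0 : ℤ
      B0 = (+ 1 + t * t * (q * q)) * Em
      separate : ∀ (t q Z F g ρ A B c : ℤ) → (+ 1 - q) * (A + c * F * g + B + (ρ + t * (q * (ρ + (+ 1 - t * q * (t * q) * Z) * F))))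
             ≡ c * F * ((+ 1 - q) * g) + (+ 1 + t * q) * ((+ 1 - q) * ρ) + (+ 1 - q) * (A + B + t * q * ((+ 1 - t * q * (t * q) * Z) * F))
      separate = solve-∀
      simplify : ∀ (t q W F Om : ℤ) →
        (t * q + t * t * (q * q) * q) * F * (+ 1 - q * W) + (+ 1 + t * q) * ((+ 1 - t * q * (t * q) * (q * W * (q * W))) * Om - (+ 1 - t * q * (t * q) * (q * W)) * F)
          + (+ 1 - q) * ((t * q + t * (t * t * (q * q)) * q) * (q * W) * F + (+ 1 + t * t * (q * q)) * F + t * q * ((+ 1 - t * q * (t * q) * (q * W)) * F))
        ≡ (+ 1 + t * q) * (+ 1 + t * (q * (q * W))) * ((+ 1 - t * (q * (q * W))) * Om - (+ 1 - t) * q * F)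
      simplify = solve-∀


-- The specialisation q = 1, where the factor 1 - q can no longer be divided out.
module AtQ1 (m : ℕ) (t : ℤ) where

  open import Defs
  open Sums
  open Reflection
  open CyclicArithmetic
  open Encoding
  open Enumeration
  open Statistics
  open import Data.Nat using (ℕ; zero; suc; _∸_)
  open import Data.Integer using (ℤ; +_; _+_; _*_; _-_; _^_)
  open import Relation.Binary.PropositionalEquality using (_≡_; refl; sym; trans; cong; cong₂; module ≡-Reasoning)
  import Data.Integer.Properties as ZP
  open import Data.Integer.Tactic.RingSolver using (solve-∀)

  open Expansion m t (+ 1)
  open Circle (suc m)
  open Windows (suc m) (+ 1)

  evenProd-at1 : ∀ k y → evenProd k y ≡ (+ 1 + y * y) ^ k
  evenProd-at1 zero y = refl
  evenProd-at1 (suc k) y = trans (cong ((+ 1 + y * y * (+ 1 * + 1)) *_) (trans (cong (evenProd k) (ZP.*-identityʳ y)) (evenProd-at1 k y)))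
                       (cong (_* (+ 1 + y * y) ^ k) (lem y))
    where lem : ∀ (y : ℤ) → + 1 + y * y * (+ 1 * + 1) ≡ + 1 + y * y
          lem = solve-∀

  geomSum-at1 : ∀ k → geomSum k ≡ + suc k
  geomSum-at1 k = trans (sumBelow-cong (suc k) (λ j _ → ZP.^-zeroˡ (k ∸ j))) (trans (sumBelow-const (suc k) (+ 1)) (ZP.*-identityʳ (+ suc k)))

  -- closed form of the wrapping total at q = 1 (there 1 - q = 0 carries no information)
  wrapTotal-at1 : ∀ k y → (+ 1 + y * y) * wrapTotal k y ≡ y * y * evenProd k y * (y * y + + k + + k + + 1)
  wrapTotal-at1 zero y = lem y
    where lem : ∀ (y : ℤ) → (+ 1 + y * y) * (y * y * (+ 1 * + 1) * + 1 + + 0) ≡ y * y * + 1 * (y * y + + 0 + + 0 + + 1)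
          lem = solve-∀
  wrapTotal-at1 (suc k) y = begin
      (+ 1 + y * y) * wrapTotal (suc k) y
    ≡⟨ cong (_*_ (+ 1 + y * y)) (trans (wrapTotal-step k y) (cong (λ u → wrapTotal k (y * + 1) + y * y * + 1 * u + y * y * (+ 1 * Z1) * evenProd (suc k) y) (wrapTotal′-eq k (y * + 1)))) ⟩
      (+ 1 + y * y) * (ρ + y * y * + 1 * (ρ + (+ 1 - y * + 1 * (y * + 1) * Z1) * Ek) + y * y * (+ 1 * Z1) * ((+ 1 + y * y * (+ 1 * + 1)) * Ek))
    ≡⟨ cong (λ u → (+ 1 + y * y) * (ρ + y * y * + 1 * (ρ + (+ 1 - y * + 1 * (y * + 1) * u) * Ek) + y * y * (+ 1 * u) * ((+ 1 + y * y * (+ 1 * + 1)) * Ek))) (ZP.^-zeroˡ (suc k)) ⟩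
      (+ 1 + y * y) * (ρ + y * y * + 1 * (ρ + (+ 1 - y * + 1 * (y * + 1) * + 1) * Ek) + y * y * (+ 1 * + 1) * ((+ 1 + y * y * (+ 1 * + 1)) * Ek))
    ≡⟨ separate y ρ Ek ⟩
      (+ 1 + y * y) * ((+ 1 + y * + 1 * (y * + 1)) * ρ) + (+ 1 + y * y) * (y * y * (+ 1 - y * y) * Ek + y * y * ((+ 1 + y * y) * Ek))
    ≡⟨ cong (λ u → (+ 1 + y * y) * u + (+ 1 + y * y) * (y * y * (+ 1 - y * y) * Ek + y * y * ((+ 1 + y * y) * Ek))) (wrapTotal-at1 k (y * + 1)) ⟩
      (+ 1 + y * y) * (y * + 1 * (y * + 1) * Ek * (y * + 1 * (y * + 1) + + k + + k + + 1)) + (+ 1 + y * y) * (y * y * (+ 1 - y * y) * Ek + y * y * ((+ 1 + y * y) * Ek))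
    ≡⟨ simplify y (+ k) Ek ⟩
      y * y * ((+ 1 + y * y * (+ 1 * + 1)) * Ek) * (y * y + (+ 1 + + k) + (+ 1 + + k) + + 1) ∎
    where
      open ≡-Reasoning
      ρ : ℤ
      ρ = wrapTotal k (y * + 1)
      Ek : ℤ
      Ek = evenProd k (y * + 1)
      Z1 : ℤ
      Z1 = (+ 1) ^ suc k
      separate : ∀ (y ρ F : ℤ) → (+ 1 + y * y) * (ρ + y * y * + 1 * (ρ + (+ 1 - y * + 1 * (y * + 1) * + 1) * F) + y * y * (+ 1 * + 1) * ((+ 1 + y * y * (+ 1 * + 1)) * F))
             ≡ (+ 1 + y * y) * ((+ 1 + y * + 1 * (y * + 1)) * ρ) + (+ 1 + y * y) * (y * y * (+ 1 - y * y) * F + y * y * ((+ 1 + y * y) * F))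
      separate = solve-∀
      simplify : ∀ (y K F : ℤ) → (+ 1 + y * y) * (y * + 1 * (y * + 1) * F * (y * + 1 * (y * + 1) + K + K + + 1)) + (+ 1 + y * y) * (y * y * (+ 1 - y * y) * F + y * y * ((+ 1 + y * y) * F))
             ≡ y * y * ((+ 1 + y * y * (+ 1 * + 1)) * F) * (y * y + (+ 1 + K) + (+ 1 + K) + + 1)
      simplify = solve-∀

  fdesGen≡genFun : fdesGen n t ≡ genFun n t (+ 1)
  fdesGen≡genFun = sumOver-cong (ABn n) (λ w → sym (trans (cong (_*_ (t ^ fdes n w)) (ZP.^-zeroˡ (fmaj n w))) (ZP.*-identityʳ _)))

  tIdentity : (+ 1 + t ^ 2) * fdesGen n t ≡ (+ 1 + t) ^ 3 * (+ 1 + t ^ 2) ^ m * (+ 1 + + m * t + t ^ 2)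
  tIdentity = begin
      (+ 1 + t ^ 2) * fdesGen n t
    ≡⟨ cong (_*_ (+ 1 + t ^ 2)) (trans fdesGen≡genFun genFun-expanded) ⟩
      (+ 1 + t ^ 2) * (A0 + midCoeff * Em * geomSum m + B0 + (ρ + t * (+ 1 * (ρ + (+ 1 - y * y * Z1) * Em))))
    ≡⟨ cong₂ (λ u v → (+ 1 + t ^ 2) * ((t * + 1 + t * (t * t * (+ 1 * + 1)) * + 1) * u * Em + midCoeff * Em * v + B0 + (ρ + t * (+ 1 * (ρ + (+ 1 - y * y * u) * Em)))))
         (ZP.^-zeroˡ (suc m)) (geomSum-at1 m) ⟩
      (+ 1 + t ^ 2) * ((t * + 1 + t * (t * t * (+ 1 * + 1)) * + 1) * + 1 * Em + midCoeff * Em * (+ 1 + + m) + B0 + (ρ + t * (+ 1 * (ρ + (+ 1 - y * y * + 1) * Em))))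
    ≡⟨ separate t (+ m) ρ Em ⟩
      (+ 1 + t * + 1) * ((+ 1 + y * y) * ρ) + (+ 1 + t * (t * + 1)) * ((t * + 1 + t * (t * t * (+ 1 * + 1)) * + 1) * Em + (t * + 1 + t * t * (+ 1 * + 1) * + 1) * Em * (+ 1 + + m) + (+ 1 + t * t * (+ 1 * + 1)) * Em + t * ((+ 1 - t * t) * Em))
    ≡⟨ cong (λ u → (+ 1 + t * + 1) * u + (+ 1 + t * (t * + 1)) * ((t * + 1 + t * (t * t * (+ 1 * + 1)) * + 1) * Em + (t * + 1 + t * t * (+ 1 * + 1) * + 1) * Em * (+ 1 + + m) + (+ 1 + t * t * (+ 1 * + 1)) * Em + t * ((+ 1 - t * t) * Em))) (wrapTotal-at1 m y) ⟩
      (+ 1 + t * + 1) * (y * y * Em * (y * y + + m + + m + + 1)) + (+ 1 + t * (t * + 1)) * ((t * + 1 + t * (t * t * (+ 1 * + 1)) * + 1) * Em + (t * + 1 + t * t * (+ 1 * + 1) * + 1) * Em * (+ 1 + + m) + (+ 1 + t * t * (+ 1 * + 1)) * Em + t * ((+ 1 - t * t) * Em))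
    ≡⟨ cong (λ u → (+ 1 + t * + 1) * (y * y * u * (y * y + + m + + m + + 1)) + (+ 1 + t * (t * + 1)) * ((t * + 1 + t * (t * t * (+ 1 * + 1)) * + 1) * u + (t * + 1 + t * t * (+ 1 * + 1) * + 1) * u * (+ 1 + + m) + (+ 1 + t * t * (+ 1 * + 1)) * u + t * ((+ 1 - t * t) * u)))
         (trans (evenProd-at1 m y) (cong (λ b → b ^ m) (square-at1 t))) ⟩
      (+ 1 + t * + 1) * (y * y * P * (y * y + + m + + m + + 1)) + (+ 1 + t * (t * + 1)) * ((t * + 1 + t * (t * t * (+ 1 * + 1)) * + 1) * P + (t * + 1 + t * t * (+ 1 * + 1) * + 1) * P * (+ 1 + + m) + (+ 1 + t * t * (+ 1 * + 1)) * P + t * ((+ 1 - t * t) * P))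
    ≡⟨ simplify t (+ m) P ⟩
      (+ 1 + t) ^ 3 * (+ 1 + t ^ 2) ^ m * (+ 1 + + m * t + t ^ 2) ∎
    where
      open ≡-Reasoning
      y : ℤ
      y = t * + 1
      ρ : ℤ
      ρ = wrapTotal m y
      Z1 : ℤ
      Z1 = (+ 1) ^ suc m
      P : ℤ
      P = (+ 1 + t ^ 2) ^ m
      A0 : ℤ
      A0 = (t * + 1 + t * (t * t * (+ 1 * + 1)) * + 1) * Z1 * Em
      B0 : ℤ
      B0 = (+ 1 + t * t * (+ 1 * + 1)) * Em
      square-at1 : ∀ (t : ℤ) → + 1 + t * + 1 * (t * + 1) ≡ + 1 + t * (t * + 1)
      square-at1 = solve-∀
      separate : ∀ (t μ ρ F : ℤ) →
        (+ 1 + t * (t * + 1)) * ((t * + 1 + t * (t * t * (+ 1 * + 1)) * + 1) * + 1 * F + (t * + 1 + t * t * (+ 1 * + 1) * + 1) * F * (+ 1 + μ) + (+ 1 + t * t * (+ 1 * + 1)) * F + (ρ + t * (+ 1 * (ρ + (+ 1 - t * + 1 * (t * + 1) * + 1) * F))))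
        ≡ (+ 1 + t * + 1) * ((+ 1 + t * + 1 * (t * + 1)) * ρ) + (+ 1 + t * (t * + 1)) * ((t * + 1 + t * (t * t * (+ 1 * + 1)) * + 1) * F + (t * + 1 + t * t * (+ 1 * + 1) * + 1) * F * (+ 1 + μ) + (+ 1 + t * t * (+ 1 * + 1)) * F + t * ((+ 1 - t * t) * F))
      separate = solve-∀
      simplify : ∀ (t μ P : ℤ) →
        (+ 1 + t * + 1) * (t * + 1 * (t * + 1) * P * (t * + 1 * (t * + 1) + μ + μ + + 1)) + (+ 1 + t * (t * + 1)) * ((t * + 1 + t * (t * t * (+ 1 * + 1)) * + 1) * P + (t * + 1 + t * t * (+ 1 * + 1) * + 1) * P * (+ 1 + μ) + (+ 1 + t * t * (+ 1 * + 1)) * P + t * ((+ 1 - t * t) * P))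
        ≡ (+ 1 + t) * ((+ 1 + t) * ((+ 1 + t) * + 1)) * P * (+ 1 + μ * t + t * (t * + 1))
      simplify = solve-∀

open import Defs
open import Data.Nat as ℕ using (suc; _≤_; s≤s; z≤n)
open import Data.Integer using (+_; _+_; _-_; _*_; _^_)
open import Data.Product using (_×_; _,_)
open import Relation.Binary.PropositionalEquality using (_≡_)

theorem5p10 : (n : ℕ) → 2 ≤ n →
    ((t q : ℤ) →
      (+ 1 - q) * genFun n t q
        ≡ (+ 1 + t * q) * (+ 1 + t * q ^ n)
          * ((+ 1 - t * q ^ n) * prodFrom1 (n ℕ.∸ 2) (λ i → + 1 + t ^ 2 * q ^ (2 ℕ.* i ℕ.+ 1))
             - (+ 1 - t) * q * prodFrom1 (n ℕ.∸ 2) (λ i → + 1 + t ^ 2 * q ^ (2 ℕ.* i ℕ.+ 2))))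
    × ((t : ℤ) →
      (+ 1 + t ^ 2) * fdesGen n t
        ≡ (+ 1 + t) ^ 3 * (+ 1 + t ^ 2) ^ (n ℕ.∸ 2) * (+ 1 + + (n ℕ.∸ 2) * t + t ^ 2))
theorem5p10 (suc (suc m)) (s≤s (s≤s z≤n)) = (λ t q → Expansion.qIdentity m t q) , (λ t → AtQ1.tIdentity m t)
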